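{- For every $j$ with $0\le j\le k$, the number $|D_j(\mathbf{a})|$ is the coefficient of $x_1^{a_1}\cdots x_k^{a_k}$ in the expansion of \[ \frac{1}{(1+x_1)\cdots(1+x_j)(1-x_1-\dots-x_k)}. \]
   Context: Let $\mathbf{a}=(a_1,\dots,a_k)$ be a sequence of nonnegative integers with $\sum_i a_i=n$, and let $c_j=\sum_{i=1}^j a_i$ (with $c_0=0$). The $j$-th block of $\mathbf{a}$ is $A_j=[c_{j-1}+1,c_j]=\{c_{j-1}+1,\dots,c_j\}\subseteq[n]=\{1,\dots,n\}$. Let $S_{\mathbf{a}}\subseteq S_n$ be the set of permutations $\pi$ of $[n]$ that have a descent ($\pi_i>\pi_{i+1}$) at every position $i$ with $i,i+1$ in the same block (i.e. $\pi$ is decreasing within each block), and may or may not have descents between blocks. A fixed point of $\pi$ is a position $i$ with $\pi_i=i$. For $0\le j\le k$, $D_j(\mathbf{a})$ denotes the set of permutations in $S_{\mathbf{a}}$ that have no fixed points in the blocks $A_1,\dots,A_j$. In particular $D_0(\mathbf{a})=S_{\mathbf{a}}$ and $D_k(\mathbf{a})$ is the set of derangements in $S_{\mathbf{a}}$. -}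

module Defs where

open import Data.Nat as ℕ using (ℕ; zero; suc; _<_; _<?_; _∸_)
open import Data.Integer as ℤ using (ℤ; +_)
open import Data.Fin as Fin using (Fin; toℕ)
open import Data.Fin.Properties using (all?; _≟_)
open import Data.Vec as Vec using (Vec; []; _∷_; lookup; replicate; _[_]≔_; zipWith)
open import Data.Vec.Properties using (≡-dec)
open import Data.List as List using (List; []; _∷_; map; concatMap; upTo; length; filter; foldr; allFin)
open import Data.Product using (_×_)
open import Relation.Binary.PropositionalEquality using (_≡_; _≢_)
open import Relation.Nullary using (Dec; yes; no; ¬?)
open import Relation.Nullary.Decidable using (_→-dec_; _×-dec_)

size : ∀ {k} → Vec ℕ k → ℕ
size = Vec.foldr _ ℕ._+_ 0

-- blockOf a p : the (0-indexed) block containing the (0-indexed)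
-- position p, i.e. the t with c_t ≤ p < c_{t+1}.
-- (Position p corresponds to the element p+1 of [n]; block t to A_{t+1}.)
blockOf : ∀ {k} → Vec ℕ k → ℕ → ℕ
blockOf []       p = 0
blockOf (a ∷ as) p with p <? a
... | yes _ = 0
... | no  _ = suc (blockOf as (p ∸ a))

-- A candidate permutation of [n] in one-line notation, 0-indexed:
-- π is a vector of length n with entries in Fin n; π_i = lookup π i.
Word : ℕ → Set
Word n = Vec (Fin n) n

IsPerm : ∀ {n} → Word n → Set
IsPerm {n} π = ∀ (i j : Fin n) → lookup π i ≡ lookup π j → i ≡ j

DecrInBlocks : ∀ {k} (a : Vec ℕ k) → Word (size a) → Set
DecrInBlocks a π =
  ∀ (i i' : Fin (size a)) → toℕ i' ≡ suc (toℕ i) →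
    blockOf a (toℕ i) ≡ blockOf a (toℕ i') → lookup π i' Fin.< lookup π i

NoFixIn : ∀ {k} (j : ℕ) (a : Vec ℕ k) → Word (size a) → Set
NoFixIn j a π = ∀ (i : Fin (size a)) → blockOf a (toℕ i) < j → lookup π i ≢ i

InD : ∀ {k} (j : ℕ) (a : Vec ℕ k) → Word (size a) → Set
InD j a π = IsPerm π × DecrInBlocks a π × NoFixIn j a π

InD? : ∀ {k} (j : ℕ) (a : Vec ℕ k) (π : Word (size a)) → Dec (InD j a π)
InD? j a π =
  all? (λ i → all? (λ i' → (lookup π i ≟ lookup π i') →-dec (i ≟ i')))
  ×-dec all? (λ i → all? (λ i' →
          (toℕ i' ℕ.≟ suc (toℕ i)) →-dec
          ((blockOf a (toℕ i) ℕ.≟ blockOf a (toℕ i')) →-dec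
           (lookup π i' Fin.<? lookup π i))))
  ×-dec all? (λ i → (blockOf a (toℕ i) <? j) →-dec ¬? (lookup π i ≟ i))

allWords : (m n : ℕ) → List (Vec (Fin n) m)
allWords zero    n = [] ∷ []
allWords (suc m) n = concatMap (λ x → map (x ∷_) (allWords m n)) (allFin n)

countD : ∀ {k} (j : ℕ) (a : Vec ℕ k) → ℕ
countD j a = length (filter (InD? j a) (allWords (size a) (size a)))

-- a series is its coefficient function: exponent vector ↦ coefficient
PowerSeries : ℕ → Set
PowerSeries k = Vec ℕ k → ℤ

sumℤ : List ℤ → ℤ
sumℤ = foldr ℤ._+_ (+ 0)

below : ∀ {k} → Vec ℕ k → List (Vec ℕ k)
below []       = [] ∷ []
below (b ∷ bs) = concatMap (λ c → map (c ∷_) (below bs)) (upTo (suc b))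

mono : ∀ {k} → Vec ℕ k → PowerSeries k
mono c b with ≡-dec ℕ._≟_ b c
... | yes _ = + 1
... | no  _ = + 0

zeroVec : ∀ k → Vec ℕ k
zeroVec k = replicate k 0

one : ∀ {k} → PowerSeries k
one {k} = mono (zeroVec k)

-- the variable x_{i+1}
var : ∀ {k} → Fin k → PowerSeries k
var {k} i = mono (zeroVec k [ i ]≔ 1)

_⊕_ : ∀ {k} → PowerSeries k → PowerSeries k → PowerSeries k
(F ⊕ G) b = F b ℤ.+ G b

_⊖_ : ∀ {k} → PowerSeries k → PowerSeries k → PowerSeries k
(F ⊖ G) b = F b ℤ.- G b

_⊛_ : ∀ {k} → PowerSeries k → PowerSeries k → PowerSeries k
(F ⊛ G) b = sumℤ (map (λ c → F c ℤ.* G (zipWith _∸_ b c)) (below b))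

sumSeries : ∀ {k} → List (PowerSeries k) → PowerSeries k
sumSeries = foldr _⊕_ (λ _ → + 0)

prodSeries : ∀ {k} → List (PowerSeries k) → PowerSeries k
prodSeries = foldr _⊛_ one

denominator : (k j : ℕ) → PowerSeries k
denominator k j =
  prodSeries (map (λ i → one ⊕ var i) (filter (λ i → toℕ i <? j) (allFin k)))
  ⊛ (one ⊖ sumSeries (map var (allFin k)))

genD : (k j : ℕ) → PowerSeries k
genD k j a = + countD j a

module Submission where

open import Defs
open import Data.Nat as ℕ using (ℕ; zero; suc; _≤_; _<_; _+_; _∸_; z≤n; s≤s; _<?_)
import Data.Nat.Properties as NP
open import Data.Nat.ListAction using (sum)
open import Data.Integer as ℤ using (ℤ; +_)
import Data.Integer.Properties as ZP
import Algebra.Properties.CommutativeSemigroup as CommSemigroupProperties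
open import Data.Bool using (Bool; true; false; if_then_else_; _∧_; T)
open import Data.Unit using (tt)
open import Data.Empty using (⊥; ⊥-elim)
open import Data.Fin as Fin using (Fin; toℕ; punchIn; punchOut; _≟_)
import Data.Fin.Properties as FP
open import Data.Vec as Vec using (Vec; []; _∷_; lookup; tabulate; zipWith; _[_]≔_)
import Data.Vec.Properties as VP
open import Data.List as List using (List; []; _∷_; map; concatMap; upTo; applyUpTo; length; filter; allFin; _++_)
import Data.List.Properties as LP
open import Data.List.Membership.Propositional using (_∈_; _∉_; lose; find)
open import Data.List.Membership.Propositional.Properties
  using (∈-map⁺; ∈-map⁻; ∈-concatMap⁺; ∈-concatMap⁻; ∈-allFin; ∈-filter⁺; ∈-filter⁻)
open import Data.List.Membership.DecPropositional ℕ._≟_ using (_∈?_)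
open import Data.List.Relation.Unary.Any using (here; there)
open import Data.List.Relation.Unary.All as All using (All; []; _∷_)
open import Data.List.Relation.Unary.All.Properties.Core using (All¬⇒¬Any)
open import Data.List.Relation.Unary.AllPairs using ([]; _∷_)
open import Data.List.Relation.Unary.Unique.Propositional using (Unique)
import Data.List.Relation.Unary.Unique.Propositional.Properties as UP
open import Data.Product using (Σ; ∃; _×_; _,_; proj₁; proj₂)
open import Data.Sum as Sum using (_⊎_; inj₁; inj₂)
open import Function using (_∘_)
open import Relation.Binary using (tri<; tri≈; tri>)
open import Relation.Binary.PropositionalEquality
open import Relation.Nullary using (¬_; Dec; yes; no; ¬?)
open import Relation.Nullary.Decidable using (_×-dec_; _→-dec_)
open import Relation.Unary using (Decidable)

-- Blocks and variables are numbered from 0.  Write c_js(b) for the number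
-- of permutations in S_b (decreasing within the blocks of the composition
-- b) without fixed points in the blocks listed in js, and C_js for the
-- series Σ_b c_js(b) x^b.  Then |D_j(b)| = c_{[0,j)}(b), and the theorem
-- says C_{[0,j)} · ∏_{i<j} (1 + x_i) · (1 - Σ_i x_i) = 1.
-- It follows from two recurrences, read as identities of series:
--   (1 + x_i) C_{i ∷ js} = C_js  for i ∉ js   (a fixed point in block i
--      is unique; deleting it, or inserting one at the unique possible
--      place, is a bijection), and
--   (1 - Σ_i x_i) C_[] = 1                    (the largest value sits at
--      the start of a block; deleting it is a bijection).
-- The file develops, in order: finite sums and shifts of power series;
-- polynomials acting on series by shifts, which makes multiplication by
-- the denominator a composite of the actions of its factors; counting
-- principles for lists; blocks of a composition; deleting and inserting
-- a letter of a word; the two bijections; and finally the theorem.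

T⇒≡true : ∀ {b} → T b → b ≡ true
T⇒≡true {true} _ = refl

¬T⇒≡false : ∀ {b} → ¬ T b → b ≡ false
¬T⇒≡false {true}  h = ⊥-elim (h tt)
¬T⇒≡false {false} _ = refl

≤ᵇ-true : ∀ {m n} → m ≤ n → (m ℕ.≤ᵇ n) ≡ true
≤ᵇ-true m≤n = T⇒≡true (NP.≤⇒≤ᵇ m≤n)

≤ᵇ-false : ∀ {m n} → ¬ m ≤ n → (m ℕ.≤ᵇ n) ≡ false
≤ᵇ-false {m} {n} m≰n = ¬T⇒≡false (m≰n ∘ NP.≤ᵇ⇒≤ m n)

≡ᵇ-true : ∀ {m n} → m ≡ n → (m ℕ.≡ᵇ n) ≡ true
≡ᵇ-true {m} {n} m≡n = T⇒≡true (NP.≡⇒≡ᵇ m n m≡n)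

≡ᵇ-false : ∀ {m n} → m ≢ n → (m ℕ.≡ᵇ n) ≡ false
≡ᵇ-false {m} {n} m≢n = ¬T⇒≡false (m≢n ∘ NP.≡ᵇ⇒≡ m n)

module ℕ+ = CommSemigroupProperties NP.+-commutativeSemigroup
module ℤ+ = CommSemigroupProperties ZP.+-commutativeSemigroup
module ℤ* = CommSemigroupProperties ZP.*-commutativeSemigroup

module _ {a} {A : Set a} where

  sumℤ-cong : ∀ {f g : A → ℤ} (xs : List A) → (∀ x → f x ≡ g x) →
              sumℤ (map f xs) ≡ sumℤ (map g xs)
  sumℤ-cong xs f≗g = cong sumℤ (LP.map-cong f≗g xs)

  sumℤ-zero : ∀ (xs : List A) → sumℤ (map (λ _ → + 0) xs) ≡ + 0
  sumℤ-zero []       = refl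
  sumℤ-zero (x ∷ xs) = trans (ZP.+-identityˡ _) (sumℤ-zero xs)

  sumℤ-scale : ∀ c (f : A → ℤ) xs → sumℤ (map (λ x → c ℤ.* f x) xs) ≡ c ℤ.* sumℤ (map f xs)
  sumℤ-scale c f []       = sym (ZP.*-zeroʳ c)
  sumℤ-scale c f (x ∷ xs) =
    trans (cong (λ y → c ℤ.* f x ℤ.+ y) (sumℤ-scale c f xs)) (sym (ZP.*-distribˡ-+ c (f x) _))

  sumℤ-+ : ∀ (f g : A → ℤ) xs →
           sumℤ (map (λ x → f x ℤ.+ g x) xs) ≡ sumℤ (map f xs) ℤ.+ sumℤ (map g xs)
  sumℤ-+ f g []       = refl
  sumℤ-+ f g (x ∷ xs) rewrite sumℤ-+ f g xs = ℤ+.interchange (f x) (g x) (sumℤ (map f xs)) (sumℤ (map g xs))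

  sumℤ-map : ∀ {b} {B : Set b} (f : B → ℤ) (g : A → B) xs →
             sumℤ (map f (map g xs)) ≡ sumℤ (map (f ∘ g) xs)
  sumℤ-map f g xs = cong sumℤ (sym (LP.map-∘ xs))

sumℤ-++ : ∀ (xs ys : List ℤ) → sumℤ (xs ++ ys) ≡ sumℤ xs ℤ.+ sumℤ ys
sumℤ-++ []       ys = sym (ZP.+-identityˡ _)
sumℤ-++ (x ∷ xs) ys = trans (cong (λ y → x ℤ.+ y) (sumℤ-++ xs ys)) (sym (ZP.+-assoc x _ _))

module _ {a b} {A : Set a} {B : Set b} where

  sumℤ-concatMap : ∀ (φ : B → ℤ) (g : A → List B) xs →
    sumℤ (map φ (concatMap g xs)) ≡ sumℤ (map (λ x → sumℤ (map φ (g x))) xs)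
  sumℤ-concatMap φ g []       = refl
  sumℤ-concatMap φ g (x ∷ xs) =
    trans (cong sumℤ (LP.map-++ φ (g x) (concatMap g xs)))
    (trans (sumℤ-++ (map φ (g x)) _) (cong (λ y → sumℤ (map φ (g x)) ℤ.+ y) (sumℤ-concatMap φ g xs)))

  sumℤ-swap : ∀ (f : A → B → ℤ) xs ys →
    sumℤ (map (λ x → sumℤ (map (f x) ys)) xs) ≡ sumℤ (map (λ y → sumℤ (map (λ x → f x y) xs)) ys)
  sumℤ-swap f []       ys = sym (sumℤ-zero ys)
  sumℤ-swap f (x ∷ xs) ys =
    trans (cong (λ y → sumℤ (map (f x) ys) ℤ.+ y) (sumℤ-swap f xs ys))
          (sym (sumℤ-+ (f x) (λ y → sumℤ (map (λ x' → f x' y) xs)) ys))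

sumℤ-ℕ : ∀ {A : Set} (h : A → ℕ) xs → sumℤ (map (λ x → + h x) xs) ≡ + sum (map h xs)
sumℤ-ℕ h []       = refl
sumℤ-ℕ h (x ∷ xs) = cong (λ y → + h x ℤ.+ y) (sumℤ-ℕ h xs)

+-if : ∀ (t : Bool) x → + (if t then x else 0) ≡ (if t then + x else + 0)
+-if true  x = refl
+-if false x = refl

_≤ᵥ_ : ∀ {k} → Vec ℕ k → Vec ℕ k → Bool
[]       ≤ᵥ []       = true
(x ∷ xs) ≤ᵥ (y ∷ ys) = (x ℕ.≤ᵇ y) ∧ (xs ≤ᵥ ys)

_∸ᵥ_ : ∀ {k} → Vec ℕ k → Vec ℕ k → Vec ℕ k
b ∸ᵥ e = zipWith _∸_ b e

_+ᵥ_ : ∀ {k} → Vec ℕ k → Vec ℕ k → Vec ℕ k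
e +ᵥ f = zipWith ℕ._+_ e f

basis : ∀ {k} → Fin k → Vec ℕ k
basis {k} i = zeroVec k [ i ]≔ 1

-- Multiplication by the monomial x^e, read off coefficientwise.
shift : ∀ {k} → Vec ℕ k → PowerSeries k → PowerSeries k
shift e F b = if e ≤ᵥ b then F (b ∸ᵥ e) else + 0

shift-cong : ∀ {k} (e : Vec ℕ k) {F G : PowerSeries k} →
             (∀ c → F c ≡ G c) → ∀ b → shift e F b ≡ shift e G b
shift-cong e F≗G b with e ≤ᵥ b
... | true  = F≗G _
... | false = refl

shift-linear : ∀ {k} {A : Set} (e : Vec ℕ k) (z : A → ℤ) (G : A → PowerSeries k) (xs : List A) b →
  shift e (λ c → sumℤ (map (λ t → z t ℤ.* G t c) xs)) b ≡ sumℤ (map (λ t → z t ℤ.* shift e (G t) b) xs)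
shift-linear e z G xs b with e ≤ᵥ b
... | true  = refl
... | false = sym (trans (sumℤ-cong xs (λ t → ZP.*-zeroʳ (z t))) (sumℤ-zero xs))

≤ᵥ-zero : ∀ {k} (b : Vec ℕ k) → (zeroVec k ≤ᵥ b) ≡ true
≤ᵥ-zero []       = refl
≤ᵥ-zero (b ∷ bs) = ≤ᵥ-zero bs

∸ᵥ-zero : ∀ {k} (b : Vec ℕ k) → b ∸ᵥ zeroVec k ≡ b
∸ᵥ-zero []       = refl
∸ᵥ-zero (b ∷ bs) = cong (b ∷_) (∸ᵥ-zero bs)

shift-zero : ∀ {k} (G : PowerSeries k) b → shift (zeroVec k) G b ≡ G b
shift-zero G b rewrite ≤ᵥ-zero b = cong G (∸ᵥ-zero b)

≤ᵇ-+ : ∀ e f b → (e ℕ.+ f ℕ.≤ᵇ b) ≡ (f ℕ.≤ᵇ b) ∧ (e ℕ.≤ᵇ b ∸ f)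
≤ᵇ-+ e f b with f ℕ.≤? b
... | no f≰b rewrite ≤ᵇ-false f≰b = ≤ᵇ-false (f≰b ∘ NP.m+n≤o⇒n≤o e)
... | yes f≤b rewrite ≤ᵇ-true f≤b with e ℕ.≤? b ∸ f
...   | yes e≤b∸f = trans (≤ᵇ-true (NP.m≤o∸n⇒m+n≤o e f≤b e≤b∸f)) (sym (≤ᵇ-true e≤b∸f))
...   | no  e≰b∸f = trans (≤ᵇ-false (e≰b∸f ∘ NP.m+n≤o⇒m≤o∸n e)) (sym (≤ᵇ-false e≰b∸f))

≤ᵥ-+ : ∀ {k} (e f b : Vec ℕ k) → ((e +ᵥ f) ≤ᵥ b) ≡ (f ≤ᵥ b) ∧ (e ≤ᵥ (b ∸ᵥ f))
≤ᵥ-+ []       []       []       = refl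
≤ᵥ-+ (e ∷ es) (f ∷ fs) (b ∷ bs) rewrite ≤ᵇ-+ e f b | ≤ᵥ-+ es fs bs =
  ∧-interchange (f ℕ.≤ᵇ b) (e ℕ.≤ᵇ b ∸ f) (fs ≤ᵥ bs) (es ≤ᵥ (bs ∸ᵥ fs))
  where
  ∧-interchange : ∀ a b c d → (a ∧ b) ∧ (c ∧ d) ≡ (a ∧ c) ∧ (b ∧ d)
  ∧-interchange true  true  c d = refl
  ∧-interchange true  false true  d = refl
  ∧-interchange true  false false d = refl
  ∧-interchange false b c d = refl

∸ᵥ-+ : ∀ {k} (e f b : Vec ℕ k) → (b ∸ᵥ f) ∸ᵥ e ≡ b ∸ᵥ (e +ᵥ f)
∸ᵥ-+ []       []       []       = refl
∸ᵥ-+ (e ∷ es) (f ∷ fs) (b ∷ bs) =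
  cong₂ _∷_ (trans (NP.∸-+-assoc b f e) (cong (b ∸_) (NP.+-comm f e))) (∸ᵥ-+ es fs bs)

shift-shift : ∀ {k} (e f : Vec ℕ k) (F : PowerSeries k) b →
              shift f (shift e F) b ≡ shift (e +ᵥ f) F b
shift-shift e f F b rewrite ≤ᵥ-+ e f b with f ≤ᵥ b
... | false = refl
... | true with e ≤ᵥ (b ∸ᵥ f)
...   | true  = cong F (∸ᵥ-+ e f b)
...   | false = refl

-- Monomials.  The coefficient of x^e at b is the product of Kronecker
-- deltas of the components, which lets the Cauchy product with x^e be
-- computed one variable at a time.

δ : ℕ → ℕ → ℤ
δ x e = if x ℕ.≡ᵇ e then + 1 else + 0

mono-spec : ∀ {k} (e b : Vec ℕ k) → (b ≡ e → mono e b ≡ + 1) × (b ≢ e → mono e b ≡ + 0)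
mono-spec e b with VP.≡-dec ℕ._≟_ b e
... | yes b≡e = (λ _ → refl) , (λ b≢e → ⊥-elim (b≢e b≡e))
... | no  b≢e = (λ b≡e → ⊥-elim (b≢e b≡e)) , (λ _ → refl)

mono-∷ : ∀ {k} x xs e (es : Vec ℕ k) → mono (e ∷ es) (x ∷ xs) ≡ δ x e ℤ.* mono es xs
mono-∷ x xs e es with x ℕ.≟ e | VP.≡-dec ℕ._≟_ xs es
... | yes refl | yes refl rewrite ≡ᵇ-true {x} refl = refl
... | yes refl | no _     rewrite ≡ᵇ-true {x} refl = refl
... | no x≢e   | _        rewrite ≡ᵇ-false x≢e    = sym (ZP.*-zeroˡ (mono es xs))

δ-sum : ∀ b e (h : ℕ → ℤ) →
  sumℤ (applyUpTo (λ c → δ (b ∸ c) e ℤ.* h c) (suc b)) ≡ (if e ℕ.≤ᵇ b then h (b ∸ e) else + 0)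
δ-sum zero zero    h = trans (ZP.+-identityʳ _) (ZP.*-identityˡ _)
δ-sum zero (suc e) h = trans (ZP.+-identityʳ _) (ZP.*-zeroˡ (h 0))
δ-sum (suc b) e h rewrite δ-sum b e (h ∘ suc) with e ℕ.≤? b
... | yes e≤b rewrite ≤ᵇ-true e≤b | ≤ᵇ-true (NP.m≤n⇒m≤1+n e≤b)
                    | ≡ᵇ-false {suc b} {e} (λ b+1≡e → NP.<⇒≢ (s≤s e≤b) (sym b+1≡e))
                    | NP.+-∸-assoc 1 e≤b =
  trans (cong (ℤ._+ h (suc (b ∸ e))) (ZP.*-zeroˡ (h 0))) (ZP.+-identityˡ _)
... | no e≰b with e ℕ.≟ suc b
...   | yes refl rewrite ≤ᵇ-false e≰b | NP.n∸n≡0 b | ≡ᵇ-true {b} refl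
                       | ≤ᵇ-true (NP.≤-refl {suc b}) =
  trans (ZP.+-identityʳ _) (ZP.*-identityˡ _)
...   | no e≢b+1 rewrite ≤ᵇ-false e≰b | ≡ᵇ-false {suc b} {e} (e≢b+1 ∘ sym)
                       | ≤ᵇ-false {e} {suc b} (λ e≤b+1 → e≢b+1 (NP.≤-antisym e≤b+1 (NP.≰⇒> e≰b))) =
  trans (ZP.+-identityʳ _) (ZP.*-zeroˡ (h 0))

shift-∷ : ∀ {k} e (es : Vec ℕ k) F b bs →
  shift (e ∷ es) F (b ∷ bs) ≡ (if e ℕ.≤ᵇ b then shift es (λ cs → F ((b ∸ e) ∷ cs)) bs else + 0)
shift-∷ e es F b bs with e ℕ.≤ᵇ b
... | true  = refl
... | false = refl

⊛-mono : ∀ {k} (F : PowerSeries k) (e b : Vec ℕ k) → (F ⊛ mono e) b ≡ shift e F b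
⊛-mono {zero} F [] [] = trans (ZP.+-identityʳ _) (ZP.*-identityʳ _)
⊛-mono {suc k} F (e ∷ es) (b ∷ bs) =
  begin
    (F ⊛ mono (e ∷ es)) (b ∷ bs)
  ≡⟨ sumℤ-concatMap term (λ c → map (c ∷_) (below bs)) (upTo (suc b)) ⟩
    sumℤ (map (λ c → sumℤ (map term (map (c ∷_) (below bs)))) (upTo (suc b)))
  ≡⟨ sumℤ-cong (upTo (suc b)) inner ⟩
    sumℤ (map (λ c → δ (b ∸ c) e ℤ.* shift es (F ∘ (c ∷_)) bs) (upTo (suc b)))
  ≡⟨ cong sumℤ (LP.map-applyUpTo (λ c → c) (λ c → δ (b ∸ c) e ℤ.* shift es (F ∘ (c ∷_)) bs) (suc b)) ⟩
    sumℤ (applyUpTo (λ c → δ (b ∸ c) e ℤ.* shift es (F ∘ (c ∷_)) bs) (suc b))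
  ≡⟨ δ-sum b e (λ c → shift es (F ∘ (c ∷_)) bs) ⟩
    (if e ℕ.≤ᵇ b then shift es (F ∘ ((b ∸ e) ∷_)) bs else + 0)
  ≡⟨ sym (shift-∷ e es F b bs) ⟩
    shift (e ∷ es) F (b ∷ bs)
  ∎
  where
  open ≡-Reasoning
  term : Vec ℕ (suc k) → ℤ
  term c = F c ℤ.* mono (e ∷ es) ((b ∷ bs) ∸ᵥ c)
  inner : ∀ c → sumℤ (map term (map (c ∷_) (below bs))) ≡ δ (b ∸ c) e ℤ.* shift es (F ∘ (c ∷_)) bs
  inner c =
    begin
      sumℤ (map term (map (c ∷_) (below bs)))
    ≡⟨ sumℤ-map term (c ∷_) (below bs) ⟩
      sumℤ (map (λ cs → F (c ∷ cs) ℤ.* mono (e ∷ es) ((b ∸ c) ∷ (bs ∸ᵥ cs))) (below bs))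
    ≡⟨ sumℤ-cong (below bs) (λ cs → trans (cong (F (c ∷ cs) ℤ.*_) (mono-∷ (b ∸ c) (bs ∸ᵥ cs) e es))
                                           (ℤ*.x∙yz≈y∙xz (F (c ∷ cs)) (δ (b ∸ c) e) _)) ⟩
      sumℤ (map (λ cs → δ (b ∸ c) e ℤ.* (F (c ∷ cs) ℤ.* mono es (bs ∸ᵥ cs))) (below bs))
    ≡⟨ sumℤ-scale (δ (b ∸ c) e) (λ cs → F (c ∷ cs) ℤ.* mono es (bs ∸ᵥ cs)) (below bs) ⟩
      δ (b ∸ c) e ℤ.* ((F ∘ (c ∷_)) ⊛ mono es) bs
    ≡⟨ cong (δ (b ∸ c) e ℤ.*_) (⊛-mono (F ∘ (c ∷_)) es bs) ⟩
      δ (b ∸ c) e ℤ.* shift es (F ∘ (c ∷_)) bs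
    ∎

<ᵇ-suc : ∀ e b → (e ℕ.<ᵇ suc b) ≡ (e ℕ.≤ᵇ b)
<ᵇ-suc zero    b = refl
<ᵇ-suc (suc e) b = refl

δ-split : ∀ b e → δ b e ≡ (if e ℕ.≤ᵇ b then δ (b ∸ e) 0 else + 0)
δ-split zero    zero    = refl
δ-split zero    (suc e) = refl
δ-split (suc b) zero    = refl
δ-split (suc b) (suc e) rewrite <ᵇ-suc e b = δ-split b e

mono≡shift-one : ∀ {k} (e b : Vec ℕ k) → mono e b ≡ shift e one b
mono≡shift-one []       []       = refl
mono≡shift-one (e ∷ es) (b ∷ bs) =
  begin
    mono (e ∷ es) (b ∷ bs)
  ≡⟨ mono-∷ b bs e es ⟩
    δ b e ℤ.* mono es bs
  ≡⟨ cong₂ ℤ._*_ (δ-split b e) (mono≡shift-one es bs) ⟩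
    (if e ℕ.≤ᵇ b then δ (b ∸ e) 0 else + 0) ℤ.* shift es one bs
  ≡⟨ if-* (e ℕ.≤ᵇ b) ⟩
    (if e ℕ.≤ᵇ b then δ (b ∸ e) 0 ℤ.* shift es one bs else + 0)
  ≡⟨ cong (λ x → if e ℕ.≤ᵇ b then x else + 0) (sym one-tail) ⟩
    (if e ℕ.≤ᵇ b then shift es (λ cs → one ((b ∸ e) ∷ cs)) bs else + 0)
  ≡⟨ sym (shift-∷ e es one b bs) ⟩
    shift (e ∷ es) one (b ∷ bs)
  ∎
  where
  open ≡-Reasoning
  if-* : ∀ (t : Bool) {x y} → (if t then x else + 0) ℤ.* y ≡ (if t then x ℤ.* y else + 0)
  if-* true          = refl
  if-* false {y = y} = ZP.*-zeroˡ y
  one-tail : shift es (λ cs → one ((b ∸ e) ∷ cs)) bs ≡ δ (b ∸ e) 0 ℤ.* shift es one bs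
  one-tail with es ≤ᵥ bs
  ... | true  = mono-∷ (b ∸ e) (bs ∸ᵥ es) 0 (zeroVec _)
  ... | false = sym (ZP.*-zeroʳ (δ (b ∸ e) 0))

-- Multiplying a series by
-- a polynomial is a linear combination of shifts (its "action"); this
-- gives associativity of the Cauchy product whenever the two right-hand
-- factors are polynomials, which is all the theorem needs.

Poly : ℕ → Set
Poly k = List (ℤ × Vec ℕ k)

⟦_⟧ : ∀ {k} → Poly k → PowerSeries k
⟦ p ⟧ b = sumℤ (map (λ (c , e) → c ℤ.* mono e b) p)

act : ∀ {k} → Poly k → PowerSeries k → PowerSeries k
act p F b = sumℤ (map (λ (c , e) → c ℤ.* shift e F b) p)

act-cong : ∀ {k} (p : Poly k) {F G : PowerSeries k} → (∀ c → F c ≡ G c) → ∀ b → act p F b ≡ act p G b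
act-cong p F≗G b = sumℤ-cong p (λ (c , e) → cong (c ℤ.*_) (shift-cong e F≗G b))

⊛-congʳ : ∀ {k} (F : PowerSeries k) {G H : PowerSeries k} → (∀ c → G c ≡ H c) → ∀ b → (F ⊛ G) b ≡ (F ⊛ H) b
⊛-congʳ F G≗H b = sumℤ-cong (below b) (λ c → cong (F c ℤ.*_) (G≗H _))

⊛-congˡ : ∀ {k} {F G : PowerSeries k} (H : PowerSeries k) → (∀ c → F c ≡ G c) → ∀ b → (F ⊛ H) b ≡ (G ⊛ H) b
⊛-congˡ H F≗G b = sumℤ-cong (below b) (λ c → cong (ℤ._* H _) (F≗G c))

⊛-⟦⟧ : ∀ {k} (F : PowerSeries k) (p : Poly k) b → (F ⊛ ⟦ p ⟧) b ≡ act p F b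
⊛-⟦⟧ F p b =
  begin
    sumℤ (map (λ c → F c ℤ.* sumℤ (map (λ (z , e) → z ℤ.* mono e (b ∸ᵥ c)) p)) (below b))
  ≡⟨ sumℤ-cong (below b) (λ c → trans (sym (sumℤ-scale (F c) _ p))
                                   (sumℤ-cong p (λ (z , e) → ℤ*.x∙yz≈y∙xz (F c) z _))) ⟩
    sumℤ (map (λ c → sumℤ (map (λ (z , e) → z ℤ.* (F c ℤ.* mono e (b ∸ᵥ c))) p)) (below b))
  ≡⟨ sumℤ-swap (λ c (z , e) → z ℤ.* (F c ℤ.* mono e (b ∸ᵥ c))) (below b) p ⟩
    sumℤ (map (λ (z , e) → sumℤ (map (λ c → z ℤ.* (F c ℤ.* mono e (b ∸ᵥ c))) (below b))) p)
  ≡⟨ sumℤ-cong p (λ (z , e) → trans (sumℤ-scale z _ (below b)) (cong (z ℤ.*_) (⊛-mono F e b))) ⟩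
    act p F b
  ∎
  where open ≡-Reasoning

_⊗_ : ∀ {k} → Poly k → Poly k → Poly k
p ⊗ q = concatMap (λ (c , e) → map (λ (d , f) → (c ℤ.* d , e +ᵥ f)) q) p

act-⊗ : ∀ {k} (p q : Poly k) F b → act (p ⊗ q) F b ≡ act q (act p F) b
act-⊗ p q F b =
  begin
    act (p ⊗ q) F b
  ≡⟨ sumℤ-concatMap _ _ p ⟩
    sumℤ (map (λ (c , e) → sumℤ (map (λ (z , g) → z ℤ.* shift g F b)
        (map (λ (d , f) → (c ℤ.* d , e +ᵥ f)) q))) p)
  ≡⟨ sumℤ-cong p (λ _ → sumℤ-map _ _ q) ⟩
    sumℤ (map (λ (c , e) → sumℤ (map (λ (d , f) → (c ℤ.* d) ℤ.* shift (e +ᵥ f) F b) q)) p)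
  ≡⟨ sumℤ-swap (λ (c , e) (d , f) → (c ℤ.* d) ℤ.* shift (e +ᵥ f) F b) p q ⟩
    sumℤ (map (λ (d , f) → sumℤ (map (λ (c , e) → (c ℤ.* d) ℤ.* shift (e +ᵥ f) F b) p)) q)
  ≡⟨ sumℤ-cong q (λ (d , f) → trans (sumℤ-cong p (λ (c , e) → step c d e f)) (sumℤ-scale d _ p)) ⟩
    sumℤ (map (λ (d , f) → d ℤ.* sumℤ (map (λ (c , e) → c ℤ.* shift f (shift e F) b) p)) q)
  ≡⟨ sumℤ-cong q (λ (d , f) → cong (d ℤ.*_) (sym (shift-linear f proj₁ (λ (_ , e) → shift e F) p b))) ⟩
    act q (act p F) b
  ∎
  where
  open ≡-Reasoning
  step : ∀ c d e f → (c ℤ.* d) ℤ.* shift (e +ᵥ f) F b ≡ d ℤ.* (c ℤ.* shift f (shift e F) b)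
  step c d e f rewrite shift-shift e f F b = ℤ*.xy∙z≈y∙xz c d (shift (e +ᵥ f) F b)

-- Hence p · q = p ⊗ q, since p = act p 1.
⟦⟧≡act-one : ∀ {k} (p : Poly k) b → ⟦ p ⟧ b ≡ act p one b
⟦⟧≡act-one p b = sumℤ-cong p (λ (c , e) → cong (c ℤ.*_) (mono≡shift-one e b))

⟦⟧-⊗ : ∀ {k} (p q : Poly k) b → (⟦ p ⟧ ⊛ ⟦ q ⟧) b ≡ ⟦ p ⊗ q ⟧ b
⟦⟧-⊗ p q b =
  begin
    (⟦ p ⟧ ⊛ ⟦ q ⟧) b   ≡⟨ ⊛-⟦⟧ ⟦ p ⟧ q b ⟩
    act q ⟦ p ⟧ b       ≡⟨ act-cong q (⟦⟧≡act-one p) b ⟩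
    act q (act p one) b ≡⟨ sym (act-⊗ p q one b) ⟩
    act (p ⊗ q) one b   ≡⟨ sym (⟦⟧≡act-one (p ⊗ q) b) ⟩
    ⟦ p ⊗ q ⟧ b         ∎
  where open ≡-Reasoning

1+x : ∀ {k} → Fin k → Poly k
1+x {k} i = (+ 1 , zeroVec k) ∷ (+ 1 , basis i) ∷ []

∏1+x : ∀ {k} → List (Fin k) → Poly k
∏1+x {k} []       = (+ 1 , zeroVec k) ∷ []
∏1+x     (i ∷ is) = 1+x i ⊗ ∏1+x is

1-Σx : ∀ k → Poly k
1-Σx k = (+ 1 , zeroVec k) ∷ map (λ i → (ℤ.-1ℤ , basis i)) (allFin k)

act-1+x : ∀ {k} (i : Fin k) G b → act (1+x i) G b ≡ G b ℤ.+ shift (basis i) G b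
act-1+x i G b = cong₂ ℤ._+_ (trans (ZP.*-identityˡ _) (shift-zero G b))
                            (trans (ZP.+-identityʳ _) (ZP.*-identityˡ _))

act-1-Σx : ∀ k G b → act (1-Σx k) G b ≡ G b ℤ.- sumℤ (map (λ i → shift (basis i) G b) (allFin k))
act-1-Σx k G b = cong₂ ℤ._+_ (trans (ZP.*-identityˡ _) (shift-zero G b)) (minus-sum (allFin k))
  where
  minus-sum : ∀ is → sumℤ (map (λ (c , e) → c ℤ.* shift e G b) (map (λ i → (ℤ.-1ℤ , basis i)) is))
                     ≡ ℤ.- sumℤ (map (λ i → shift (basis i) G b) is)
  minus-sum []       = refl
  minus-sum (i ∷ is) = trans (cong₂ ℤ._+_ (ZP.-1*i≡-i (shift (basis i) G b)) (minus-sum is))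
                             (sym (ZP.neg-distrib-+ (shift (basis i) G b) _))

1+x-⟦⟧ : ∀ {k} (i : Fin k) b → (one ⊕ var i) b ≡ ⟦ 1+x i ⟧ b
1+x-⟦⟧ i b = cong₂ ℤ._+_ (sym (ZP.*-identityˡ (one b)))
                         (sym (trans (ZP.+-identityʳ _) (ZP.*-identityˡ (var i b))))

∏1+x-⟦⟧ : ∀ {k} (is : List (Fin k)) b → prodSeries (map (λ i → one ⊕ var i) is) b ≡ ⟦ ∏1+x is ⟧ b
∏1+x-⟦⟧ []       b = sym (trans (ZP.+-identityʳ _) (ZP.*-identityˡ (one b)))
∏1+x-⟦⟧ (i ∷ is) b =
  trans (⊛-congˡ (prodSeries (map (λ i → one ⊕ var i) is)) (1+x-⟦⟧ i) b)
  (trans (⊛-congʳ ⟦ 1+x i ⟧ (∏1+x-⟦⟧ is) b) (⟦⟧-⊗ (1+x i) (∏1+x is) b))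

1-Σx-⟦⟧ : ∀ k b → (one ⊖ sumSeries (map var (allFin k))) b ≡ ⟦ 1-Σx k ⟧ b
1-Σx-⟦⟧ k b = cong₂ ℤ._+_ (sym (ZP.*-identityˡ (one b))) (minus-sum (allFin k))
  where
  minus-sum : ∀ is → ℤ.- sumSeries (map var is) b
                     ≡ sumℤ (map (λ (c , e) → c ℤ.* mono e b) (map (λ i → (ℤ.-1ℤ , basis i)) is))
  minus-sum []       = refl
  minus-sum (i ∷ is) = trans (ZP.neg-distrib-+ (var i b) _) (cong₂ ℤ._+_ (sym (ZP.-1*i≡-i (var i b))) (minus-sum is))

firstIndices : (k j : ℕ) → List (Fin k)
firstIndices k j = filter (λ i → toℕ i <? j) (allFin k)

⊛-denominator : ∀ k j (F : PowerSeries k) b →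
  (F ⊛ denominator k j) b ≡ act (1-Σx k) (act (∏1+x (firstIndices k j)) F) b
⊛-denominator k j F b =
  begin
    (F ⊛ denominator k j) b
  ≡⟨ ⊛-congʳ F denominator-⟦⟧ b ⟩
    (F ⊛ ⟦ ∏1+x is ⊗ 1-Σx k ⟧) b
  ≡⟨ ⊛-⟦⟧ F (∏1+x is ⊗ 1-Σx k) b ⟩
    act (∏1+x is ⊗ 1-Σx k) F b
  ≡⟨ act-⊗ (∏1+x is) (1-Σx k) F b ⟩
    act (1-Σx k) (act (∏1+x is) F) b
  ∎
  where
  open ≡-Reasoning
  is : List (Fin k)
  is = firstIndices k j
  denominator-⟦⟧ : ∀ c → denominator k j c ≡ ⟦ ∏1+x is ⊗ 1-Σx k ⟧ c
  denominator-⟦⟧ c =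
    trans (⊛-congˡ (one ⊖ sumSeries (map var (allFin k))) (∏1+x-⟦⟧ is) c)
    (trans (⊛-congʳ ⟦ ∏1+x is ⟧ (1-Σx-⟦⟧ k) c) (⟦⟧-⊗ (∏1+x is) (1-Σx k) c))

allWords-complete : ∀ m n (v : Vec (Fin n) m) → v ∈ allWords m n
allWords-complete zero    n []      = here refl
allWords-complete (suc m) n (x ∷ v) =
  ∈-concatMap⁺ (λ y → map (y ∷_) (allWords m n))
    (lose (∈-allFin x) (∈-map⁺ (x ∷_) (allWords-complete m n v)))

allWords-unique : ∀ m n → Unique (allWords m n)
allWords-unique zero    n = [] ∷ []
allWords-unique (suc m) n = prefixes-unique (allFin n) (UP.allFin⁺ n)
  where
  L : List (Vec (Fin n) m)
  L = allWords m n
  prefixes-unique : ∀ xs → Unique xs → Unique (concatMap (λ x → map (x ∷_) L) xs)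
  prefixes-unique []       _       = []
  prefixes-unique (x ∷ xs) (x∉xs ∷ u) =
    UP.++⁺ (UP.map⁺ VP.∷-injectiveʳ (allWords-unique m n)) (prefixes-unique xs u) disjoint
    where
    disjoint : ∀ {v} → ¬ (v ∈ map (x ∷_) L × v ∈ concatMap (λ x → map (x ∷_) L) xs)
    disjoint (v∈x∷L , v∈rest) with ∈-map⁻ (x ∷_) v∈x∷L
                                 | find (∈-concatMap⁻ (λ x → map (x ∷_) L) {xs = xs} v∈rest)
    ... | _ , _ , refl | x' , x'∈xs , v∈x'∷L with ∈-map⁻ (x' ∷_) v∈x'∷L
    ...   | _ , _ , x∷w≡x'∷w' = All.lookup x∉xs x'∈xs (VP.∷-injectiveˡ x∷w≡x'∷w')

module _ {a p q} {A : Set a} {P : A → Set p} {Q : A → Set q} (P? : Decidable P) (Q? : Decidable Q) where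

  count-≐ : (∀ {x} → P x → Q x) → (∀ {x} → Q x → P x) → ∀ xs → length (filter P? xs) ≡ length (filter Q? xs)
  count-≐ P⇒Q Q⇒P xs = cong length (LP.filter-≐ P? Q? (P⇒Q , Q⇒P) xs)

  count-⊎ : ∀ {r} {R : A → Set r} (R? : Decidable R) →
    (∀ {x} → P x → Q x ⊎ R x) → (∀ {x} → Q x → P x) → (∀ {x} → R x → P x) → (∀ {x} → Q x → ¬ R x) →
    ∀ xs → length (filter P? xs) ≡ length (filter Q? xs) + length (filter R? xs)
  count-⊎ R? P⇒Q⊎R Q⇒P R⇒P Q⇒¬R [] = refl
  count-⊎ R? P⇒Q⊎R Q⇒P R⇒P Q⇒¬R (x ∷ xs) with ih ← count-⊎ R? P⇒Q⊎R Q⇒P R⇒P Q⇒¬R xs | P? x | Q? x | R? x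
  ... | yes _  | yes Qx | yes Rx = ⊥-elim (Q⇒¬R Qx Rx)
  ... | yes _  | yes _  | no  _  = cong suc ih
  ... | yes _  | no  _  | yes _  = trans (cong suc ih) (sym (NP.+-suc _ _))
  ... | yes Px | no ¬Qx | no ¬Rx = ⊥-elim (Sum.[ ¬Qx , ¬Rx ] (P⇒Q⊎R Px))
  ... | no ¬Px | yes Qx | _      = ⊥-elim (¬Px (Q⇒P Qx))
  ... | no ¬Px | no _   | yes Rx = ⊥-elim (¬Px (R⇒P Rx))
  ... | no _   | no _   | no _   = ih

count-none : ∀ {a p} {A : Set a} {P : A → Set p} (P? : Decidable P) → (∀ x → ¬ P x) →
             ∀ xs → length (filter P? xs) ≡ 0
count-none P? ¬P xs = cong length (LP.filter-none P? (All.universal ¬P xs))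

module _ {a b} {A : Set a} {B : Set b} where

  private
    remove : ∀ {y : B} {ys} → y ∈ ys →
      Σ (List B) λ ys' → length ys ≡ suc (length ys') × (∀ {z} → z ∈ ys → z ≢ y → z ∈ ys')
    remove {ys = _ ∷ ys} (here refl) =
      ys , refl , λ { (here refl) z≢y → ⊥-elim (z≢y refl) ; (there z∈ys) _ → z∈ys }
    remove {ys = w ∷ ys} (there y∈ys) with remove y∈ys
    ... | ys' , len , keep =
      w ∷ ys' , cong suc len , λ { (here refl) _ → here refl ; (there z∈ys) z≢y → there (keep z∈ys z≢y) }

  pigeonhole : ∀ (f : A → B) (xs : List A) (ys : List B) → Unique xs →
    (∀ {x} → x ∈ xs → f x ∈ ys) → (∀ {x x'} → x ∈ xs → x' ∈ xs → f x ≡ f x' → x ≡ x') →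
    length xs ≤ length ys
  pigeonhole f []       ys _             _    _   = z≤n
  pigeonhole f (x ∷ xs) ys (x∉xs ∷ uniq) into inj with remove (into (here refl))
  ... | ys' , len , keep = subst (suc (length xs) ≤_) (sym len) (s≤s (pigeonhole f xs ys' uniq into' inj'))
    where
    into' : ∀ {x'} → x' ∈ xs → f x' ∈ ys'
    into' x'∈xs = keep (into (there x'∈xs))
                       (λ fx'≡fx → All.lookup x∉xs x'∈xs (sym (inj (there x'∈xs) (here refl) fx'≡fx)))
    inj' : ∀ {x₁ x₂} → x₁ ∈ xs → x₂ ∈ xs → f x₁ ≡ f x₂ → x₁ ≡ x₂
    inj' m₁ m₂ = inj (there m₁) (there m₂)

module _ {a b p q} {A : Set a} {B : Set b} {P : A → Set p} {Q : B → Set q}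
         (P? : Decidable P) (Q? : Decidable Q) where

  count-≤ : (f : A → B) (g : B → A) → (∀ {x} → P x → Q (f x)) → (∀ {x} → P x → g (f x) ≡ x) →
    (xs : List A) (ys : List B) → Unique xs → (∀ y → y ∈ ys) →
    length (filter P? xs) ≤ length (filter Q? ys)
  count-≤ f g P⇒Qf gf≡id xs ys uniq complete =
    pigeonhole f (filter P? xs) (filter Q? ys) (UP.filter⁺ P? uniq)
      (λ x∈ → ∈-filter⁺ Q? (complete _) (P⇒Qf (P-of x∈)))
      (λ {x} {x'} x∈ x'∈ fx≡fx' → trans (sym (gf≡id (P-of x∈))) (trans (cong g fx≡fx') (gf≡id (P-of x'∈))))
    where
    P-of : ∀ {x} → x ∈ filter P? xs → P x
    P-of x∈ = proj₂ (∈-filter⁻ P? {xs = xs} x∈)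

module _ {a p q} {A : Set a} {P : A → Set p} {k} {Q : Fin k → A → Set q}
         (P? : Decidable P) (Q? : ∀ i → Decidable (Q i))
         (Q⇒P : ∀ {i x} → Q i x → P x) (P⇒Q : ∀ {x} → P x → ∃ λ i → Q i x)
         (Q-unique : ∀ {i i' x} → Q i x → Q i' x → i ≡ i') where

  private
    ind : ∀ {ℓ} {X : Set ℓ} → Dec X → ℕ
    ind (yes _) = 1
    ind (no  _) = 0

    length-filter-∷ : ∀ {r} {R : A → Set r} (R? : Decidable R) x xs →
      length (filter R? (x ∷ xs)) ≡ ind (R? x) + length (filter R? xs)
    length-filter-∷ R? x xs with R? x
    ... | yes _ = refl
    ... | no  _ = refl

    sum-cong : ∀ {B : Set} {f g : B → ℕ} xs → (∀ x → f x ≡ g x) → sum (map f xs) ≡ sum (map g xs)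
    sum-cong xs f≗g = cong sum (LP.map-cong f≗g xs)

    sum-+ : ∀ {B : Set} (f g : B → ℕ) xs → sum (map (λ x → f x + g x) xs) ≡ sum (map f xs) + sum (map g xs)
    sum-+ f g []       = refl
    sum-+ f g (x ∷ xs) rewrite sum-+ f g xs = ℕ+.interchange (f x) (g x) (sum (map f xs)) (sum (map g xs))

    sum-zeros : ∀ {B : Set} (xs : List B) → sum (map (λ _ → 0) xs) ≡ 0
    sum-zeros []       = refl
    sum-zeros (_ ∷ xs) = sum-zeros xs

    no-class : ∀ x is → (∀ i → ¬ Q i x) → sum (map (λ i → ind (Q? i x)) is) ≡ 0
    no-class x []       _   = refl
    no-class x (i ∷ is) ¬Q with Q? i x
    ... | yes Qix = ⊥-elim (¬Q i Qix)
    ... | no  _   = no-class x is ¬Q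

    one-class : ∀ x is i₀ → Unique is → i₀ ∈ is → Q i₀ x → sum (map (λ i → ind (Q? i x)) is) ≡ 1
    one-class x (i ∷ is) i₀ (i∉is ∷ _) (here refl) Qi₀x with Q? i x
    ... | no ¬Qix = ⊥-elim (¬Qix Qi₀x)
    ... | yes _   = cong suc (others is i∉is)
      where
      others : ∀ is → All (i ≢_) is → sum (map (λ i → ind (Q? i x)) is) ≡ 0
      others []        _           = refl
      others (i' ∷ is) (i≢i' ∷ ne) with Q? i' x
      ... | yes Qi'x = ⊥-elim (i≢i' (Q-unique Qi₀x Qi'x))
      ... | no  _    = others is ne
    one-class x (i ∷ is) i₀ (i∉is ∷ uniq) (there i₀∈is) Qi₀x with Q? i x
    ... | yes Qix = ⊥-elim (All.lookup i∉is i₀∈is (Q-unique Qix Qi₀x))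
    ... | no  _   = one-class x is i₀ uniq i₀∈is Qi₀x

  count-partition : ∀ xs → length (filter P? xs) ≡ sum (map (λ i → length (filter (Q? i) xs)) (allFin k))
  count-partition []       = sym (sum-zeros (allFin k))
  count-partition (x ∷ xs) =
    begin
      length (filter P? (x ∷ xs))
    ≡⟨ length-filter-∷ P? x xs ⟩
      ind (P? x) + length (filter P? xs)
    ≡⟨ cong₂ _+_ (classes (P? x)) (count-partition xs) ⟩
      sum (map (λ i → ind (Q? i x)) (allFin k)) + sum (map (λ i → length (filter (Q? i) xs)) (allFin k))
    ≡⟨ sym (sum-+ (λ i → ind (Q? i x)) (λ i → length (filter (Q? i) xs)) (allFin k)) ⟩
      sum (map (λ i → ind (Q? i x) + length (filter (Q? i) xs)) (allFin k))
    ≡⟨ sum-cong (allFin k) (λ i → sym (length-filter-∷ (Q? i) x xs)) ⟩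
      sum (map (λ i → length (filter (Q? i) (x ∷ xs))) (allFin k))
    ∎
    where
    open ≡-Reasoning
    classes : (d : Dec (P x)) → ind d ≡ sum (map (λ i → ind (Q? i x)) (allFin k))
    classes (yes Px) = let (i₀ , Qi₀x) = P⇒Q Px in
                       sym (one-class x (allFin k) i₀ (UP.allFin⁺ k) (∈-allFin i₀) Qi₀x)
    classes (no ¬Px) = sym (no-class x (allFin k) (λ i Qix → ¬Px (Q⇒P Qix)))

blockStart : ∀ {k} → Vec ℕ k → Fin k → ℕ
blockStart (a ∷ as) Fin.zero    = 0
blockStart (a ∷ as) (Fin.suc i) = a + blockStart as i

private
  ∸-<  : ∀ {a q x} → a ≤ q → q < a + x → q ∸ a < x
  ∸-<  {a} a≤q q<a+x = NP.+-cancelˡ-< a _ _ (subst (_< a + _) (sym (NP.m+[n∸m]≡n a≤q)) q<a+x)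

  <-∸  : ∀ {a q x} → a ≤ q → q ∸ a < x → q < a + x
  <-∸  {a} a≤q q∸a<x = subst (_< a + _) (NP.m+[n∸m]≡n a≤q) (NP.+-monoʳ-< a q∸a<x)

  ∸-≤  : ∀ {a q x} → a + x ≤ q → x ≤ q ∸ a
  ∸-≤  {a} {q} {x} a+x≤q = NP.m+n≤o⇒m≤o∸n x (subst (_≤ q) (NP.+-comm a x) a+x≤q)

  ≤-∸  : ∀ {a q x} → a ≤ q → x ≤ q ∸ a → a + x ≤ q
  ≤-∸  {a} a≤q x≤q∸a = subst (a + _ ≤_) (NP.m+[n∸m]≡n a≤q) (NP.+-monoʳ-≤ a x≤q∸a)

blockOf-≡ : ∀ {k} (a : Vec ℕ k) (i : Fin k) q →
            blockStart a i ≤ q → q < blockStart a i + lookup a i → blockOf a q ≡ toℕ i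
blockOf-≡ (a ∷ as) Fin.zero q _ q<a with q <? a
... | yes _   = refl
... | no  q≮a = ⊥-elim (q≮a q<a)
blockOf-≡ (a ∷ as) (Fin.suc i) q start≤q q<end with q <? a
... | yes q<a = ⊥-elim (NP.<⇒≱ q<a (NP.≤-trans (NP.m≤m+n a _) start≤q))
... | no  q≮a = cong suc (blockOf-≡ as i (q ∸ a) (∸-≤ start≤q)
                          (∸-< (NP.≮⇒≥ q≮a) (subst (q <_) (NP.+-assoc a _ _) q<end)))

blockOf-bounds : ∀ {k} (a : Vec ℕ k) (i : Fin k) q → blockOf a q ≡ toℕ i →
                 blockStart a i ≤ q × q < blockStart a i + lookup a i
blockOf-bounds (a ∷ as) i q eq with q <? a
blockOf-bounds (a ∷ as) Fin.zero    q eq | yes q<a = z≤n , q<a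
blockOf-bounds (a ∷ as) Fin.zero    q () | no  _
blockOf-bounds (a ∷ as) (Fin.suc i) q () | yes _
blockOf-bounds (a ∷ as) (Fin.suc i) q eq | no  q≮a =
  let a≤q = NP.≮⇒≥ q≮a
      (start≤ , <end) = blockOf-bounds as i (q ∸ a) (NP.suc-injective eq)
  in ≤-∸ a≤q start≤ , subst (q <_) (sym (NP.+-assoc a _ _)) (<-∸ a≤q <end)

blockOf-exists : ∀ {k} (a : Vec ℕ k) q → q < size a → Σ (Fin k) λ i → blockOf a q ≡ toℕ i
blockOf-exists []       q ()
blockOf-exists (a ∷ as) q q<size with q <? a
... | yes _   = Fin.zero , refl
... | no  q≮a with blockOf-exists as (q ∸ a) (∸-< (NP.≮⇒≥ q≮a) q<size)
...   | i , eq = Fin.suc i , cong suc eq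

blockOf-mono : ∀ {k} (a : Vec ℕ k) {q q'} → q ≤ q' → blockOf a q ≤ blockOf a q'
blockOf-mono []       _    = z≤n
blockOf-mono (a ∷ as) {q} {q'} q≤q' with q <? a | q' <? a
... | yes _   | _       = z≤n
... | no  q≮a | yes q'<a = ⊥-elim (q≮a (NP.≤-<-trans q≤q' q'<a))
... | no  _   | no  _    = s≤s (blockOf-mono as (NP.∸-monoˡ-≤ a q≤q'))

blockOf-between : ∀ {k} (a : Vec ℕ k) {q r q'} → q ≤ r → r ≤ q' →
                  blockOf a q ≡ blockOf a q' → blockOf a q ≡ blockOf a r
blockOf-between a q≤r r≤q' same =
  NP.≤-antisym (blockOf-mono a q≤r) (subst (blockOf a _ ≤_) (sym same) (blockOf-mono a r≤q'))

nonempty-block : ∀ {k} (a : Vec ℕ k) (i : Fin k) {q} →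
                 blockStart a i ≤ q → q < blockStart a i + lookup a i → 1 ≤ lookup a i
nonempty-block a i start≤q q<end =
  NP.+-cancelˡ-< (blockStart a i) 0 (lookup a i)
    (subst (_< blockStart a i + lookup a i) (sym (NP.+-identityʳ _)) (NP.≤-<-trans start≤q q<end))

blockEnd≤size : ∀ {k} (a : Vec ℕ k) (i : Fin k) → blockStart a i + lookup a i ≤ size a
blockEnd≤size (a ∷ as) Fin.zero    = NP.m≤m+n a _
blockEnd≤size (a ∷ as) (Fin.suc i) =
  subst (_≤ a + size as) (sym (NP.+-assoc a _ _)) (NP.+-monoʳ-≤ a (blockEnd≤size as i))

size≡0⇒zeroVec : ∀ {k} (b : Vec ℕ k) → size b ≡ 0 → b ≡ zeroVec k
size≡0⇒zeroVec []           _ = refl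
size≡0⇒zeroVec (zero ∷ bs) eq = cong (0 ∷_) (size≡0⇒zeroVec bs eq)

size-zeroVec : ∀ k → size (zeroVec k) ≡ 0
size-zeroVec zero    = refl
size-zeroVec (suc k) = size-zeroVec k

≤ᵥ-basis : ∀ {k} (i : Fin k) (b : Vec ℕ k) → (basis i ≤ᵥ b) ≡ (1 ℕ.≤ᵇ lookup b i)
≤ᵥ-basis Fin.zero (b ∷ bs) rewrite ≤ᵥ-zero bs with 1 ℕ.≤ᵇ b
... | true  = refl
... | false = refl
≤ᵥ-basis (Fin.suc i) (b ∷ bs) = ≤ᵥ-basis i bs

shift-basis : ∀ {k} (i : Fin k) G (b : Vec ℕ k) →
  shift (basis i) G b ≡ (if 1 ℕ.≤ᵇ lookup b i then G (b ∸ᵥ basis i) else + 0)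
shift-basis i G b rewrite ≤ᵥ-basis i b = refl

blockStart-removal : ∀ {k} (a : Vec ℕ k) (i : Fin k) → blockStart (a ∸ᵥ basis i) i ≡ blockStart a i
blockStart-removal (a ∷ as) Fin.zero    = refl
blockStart-removal (a ∷ as) (Fin.suc i) = cong (a ℕ.+_) (blockStart-removal as i)

lookup-removal : ∀ {k} (a : Vec ℕ k) (i : Fin k) → lookup (a ∸ᵥ basis i) i ≡ lookup a i ∸ 1
lookup-removal (a ∷ as) Fin.zero    = refl
lookup-removal (a ∷ as) (Fin.suc i) = lookup-removal as i

size-removal : ∀ {k} (a : Vec ℕ k) (i : Fin k) → 1 ≤ lookup a i → size a ≡ suc (size (a ∸ᵥ basis i))
size-removal (suc a ∷ as) Fin.zero    _ rewrite ∸ᵥ-zero as = refl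
size-removal (a ∷ as)     (Fin.suc i) h = trans (cong (a ℕ.+_) (size-removal as i h)) (NP.+-suc a _)

blockOf-removal : ∀ {k} (a : Vec ℕ k) (i : Fin k) p →
  blockStart a i ≤ p → p < blockStart a i + lookup a i → ∀ q →
  (q < p → blockOf (a ∸ᵥ basis i) q ≡ blockOf a q) × (p ≤ q → blockOf (a ∸ᵥ basis i) q ≡ blockOf a (suc q))
blockOf-removal (zero ∷ as) Fin.zero p _ () q
blockOf-removal (suc a ∷ as) Fin.zero p _ p<a+1 q rewrite ∸ᵥ-zero as = before , after
  where
  before : q < p → blockOf (a ∷ as) q ≡ blockOf (suc a ∷ as) q
  before q<p with q <? a | q <? suc a
  ... | yes _   | yes _    = refl
  ... | no  q≮a | _        = ⊥-elim (q≮a (NP.<-≤-trans q<p (NP.≤-pred p<a+1)))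
  ... | yes q<a | no  q≮a+1 = ⊥-elim (q≮a+1 (NP.m≤n⇒m≤1+n q<a))
  after : p ≤ q → blockOf (a ∷ as) q ≡ blockOf (suc a ∷ as) (suc q)
  after _ with q <? a | suc q <? suc a
  ... | yes _   | yes _    = refl
  ... | no  _   | no  _    = refl
  ... | yes q<a | no  ≮    = ⊥-elim (≮ (s≤s q<a))
  ... | no  q≮a | yes <    = ⊥-elim (q≮a (NP.≤-pred <))
blockOf-removal (a ∷ as) (Fin.suc i) p start≤p p<end q = before , after
  where
  a≤p : a ≤ p
  a≤p = NP.≤-trans (NP.m≤m+n a _) start≤p
  rest : (q ∸ a < p ∸ a → blockOf (as ∸ᵥ basis i) (q ∸ a) ≡ blockOf as (q ∸ a)) ×
         (p ∸ a ≤ q ∸ a → blockOf (as ∸ᵥ basis i) (q ∸ a) ≡ blockOf as (suc (q ∸ a)))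
  rest = blockOf-removal as i (p ∸ a) (∸-≤ start≤p) (∸-< a≤p (subst (p <_) (NP.+-assoc a _ _) p<end)) (q ∸ a)
  before : q < p → blockOf (a ∷ (as ∸ᵥ basis i)) q ≡ blockOf (a ∷ as) q
  before q<p with q <? a
  ... | yes _   = refl
  ... | no  q≮a = cong suc (proj₁ rest (NP.∸-monoˡ-< q<p (NP.≮⇒≥ q≮a)))
  after : p ≤ q → blockOf (a ∷ (as ∸ᵥ basis i)) q ≡ blockOf (a ∷ as) (suc q)
  after p≤q with q <? a | suc q <? a
  ... | yes q<a | _       = ⊥-elim (NP.<⇒≱ q<a (NP.≤-trans a≤p p≤q))
  ... | no  _   | yes q<a = ⊥-elim (NP.<⇒≱ q<a (NP.m≤n⇒m≤1+n (NP.≤-trans a≤p p≤q)))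
  ... | no  _   | no  _   = cong suc (trans (proj₂ rest (NP.∸-monoˡ-≤ a p≤q))
                                          (cong (blockOf as) (sym (NP.+-∸-assoc 1 (NP.≤-trans a≤p p≤q)))))

vec-ext : ∀ {A : Set} {n} {xs ys : Vec A n} → (∀ i → lookup xs i ≡ lookup ys i) → xs ≡ ys
vec-ext {xs = xs} {ys} xs≗ys =
  trans (sym (VP.tabulate∘lookup xs)) (trans (VP.tabulate-cong xs≗ys) (VP.tabulate∘lookup ys))

toℕ-punchIn-< : ∀ {n} (p : Fin (suc n)) (x : Fin n) → toℕ x < toℕ p → toℕ (punchIn p x) ≡ toℕ x
toℕ-punchIn-< (Fin.suc p) Fin.zero    _         = refl
toℕ-punchIn-< (Fin.suc p) (Fin.suc x) (s≤s x<p) = cong suc (toℕ-punchIn-< p x x<p)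

toℕ-punchIn-≥ : ∀ {n} (p : Fin (suc n)) (x : Fin n) → toℕ p ≤ toℕ x → toℕ (punchIn p x) ≡ suc (toℕ x)
toℕ-punchIn-≥ Fin.zero    x           _         = refl
toℕ-punchIn-≥ (Fin.suc p) (Fin.suc x) (s≤s p≤x) = cong suc (toℕ-punchIn-≥ p x p≤x)

toℕ-punchOut-< : ∀ {n} {v y : Fin (suc n)} (v≢y : v ≢ y) → toℕ y < toℕ v → toℕ (punchOut v≢y) ≡ toℕ y
toℕ-punchOut-< {suc n} {Fin.suc v} {Fin.zero}  _   _         = refl
toℕ-punchOut-< {suc n} {Fin.suc v} {Fin.suc y} v≢y (s≤s y<v) = cong suc (toℕ-punchOut-< (v≢y ∘ cong Fin.suc) y<v)

toℕ-punchOut-> : ∀ {n} {v y : Fin (suc n)} (v≢y : v ≢ y) → toℕ v < toℕ y → suc (toℕ (punchOut v≢y)) ≡ toℕ y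
toℕ-punchOut-> {n}     {Fin.zero}  {Fin.suc y} _   _         = refl
toℕ-punchOut-> {suc n} {Fin.suc v} {Fin.suc y} v≢y (s≤s v<y) = cong suc (toℕ-punchOut-> (v≢y ∘ cong Fin.suc) v<y)

punchIn-mono-< : ∀ {n} (p : Fin (suc n)) {x y : Fin n} → x Fin.< y → punchIn p x Fin.< punchIn p y
punchIn-mono-< p {x} {y} x<y = NP.≰⇒> (λ py≤px → NP.<⇒≱ x<y (FP.punchIn-cancel-≤ p y x py≤px))

punchOut-mono-< : ∀ {n} {v x y : Fin (suc n)} (v≢x : v ≢ x) (v≢y : v ≢ y) →
                  x Fin.< y → punchOut v≢x Fin.< punchOut v≢y
punchOut-mono-< v≢x v≢y x<y = NP.≰⇒> (λ py≤px → NP.<⇒≱ x<y (FP.punchOut-cancel-≤ v≢y v≢x py≤px))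

position-view : ∀ {m} (p q : Fin (suc m)) → (q ≡ p) ⊎ Σ (Fin m) (λ x → q ≡ punchIn p x)
position-view p q with p ≟ q
... | yes p≡q = inj₁ (sym p≡q)
... | no  p≢q = inj₂ (punchOut p≢q , sym (FP.punchIn-punchOut p≢q))

-- Deleting position p of π removes
-- the value π(p) and closes the gap in the values; inserting value v
-- at position p opens a gap at v.

-- y renumbered after removing v from Fin (suc m); d is a dummy for y = v.
squeeze : ∀ {m} → Fin m → Fin (suc m) → Fin (suc m) → Fin m
squeeze d v y with v ≟ y
... | yes _   = d
... | no  v≢y = punchOut v≢y

squeeze-≢ : ∀ {m} (d : Fin m) {v y} (v≢y : v ≢ y) → squeeze d v y ≡ punchOut v≢y
squeeze-≢ d {v} {y} v≢y with v ≟ y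
... | yes v≡y = ⊥-elim (v≢y v≡y)
... | no  _   = FP.punchOut-cong v refl

delete : ∀ {m} → Fin (suc m) → Word (suc m) → Word m
delete p π = tabulate (λ x → squeeze x (lookup π p) (lookup π (punchIn p x)))

insert : ∀ {m} → Fin (suc m) → Fin (suc m) → Word m → Word (suc m)
insert p v σ = Vec.insertAt (Vec.map (punchIn v) σ) p v

module _ {m} (p v : Fin (suc m)) (σ : Word m) where

  lookup-insert-here : lookup (insert p v σ) p ≡ v
  lookup-insert-here = VP.insertAt-lookup (Vec.map (punchIn v) σ) p v

  lookup-insert-punchIn : ∀ x → lookup (insert p v σ) (punchIn p x) ≡ punchIn v (lookup σ x)
  lookup-insert-punchIn x =
    trans (VP.insertAt-punchIn (Vec.map (punchIn v) σ) p v x) (VP.lookup-map x (punchIn v) σ)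

  insert-perm : IsPerm σ → IsPerm (insert p v σ)
  insert-perm σ-perm q₁ q₂ same with position-view p q₁ | position-view p q₂
  ... | inj₁ q₁≡p        | inj₁ q₂≡p        = trans q₁≡p (sym q₂≡p)
  ... | inj₁ refl        | inj₂ (x , refl)  =
    ⊥-elim (FP.punchInᵢ≢i v (lookup σ x)
      (sym (trans (sym lookup-insert-here) (trans same (lookup-insert-punchIn x)))))
  ... | inj₂ (x , refl)  | inj₁ refl        =
    ⊥-elim (FP.punchInᵢ≢i v (lookup σ x) (trans (sym (lookup-insert-punchIn x)) (trans same lookup-insert-here)))
  ... | inj₂ (x , refl)  | inj₂ (y , refl)  =
    cong (punchIn p) (σ-perm x y (FP.punchIn-injective v _ _
      (trans (sym (lookup-insert-punchIn x)) (trans same (lookup-insert-punchIn y)))))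

  delete-insert : delete p (insert p v σ) ≡ σ
  delete-insert = vec-ext λ x →
    begin
      lookup (delete p (insert p v σ)) x
    ≡⟨ VP.lookup∘tabulate _ x ⟩
      squeeze x (lookup (insert p v σ) p) (lookup (insert p v σ) (punchIn p x))
    ≡⟨ cong₂ (squeeze x) lookup-insert-here (lookup-insert-punchIn x) ⟩
      squeeze x v (punchIn v (lookup σ x))
    ≡⟨ squeeze-≢ x (FP.punchInᵢ≢i v (lookup σ x) ∘ sym) ⟩
      punchOut (FP.punchInᵢ≢i v (lookup σ x) ∘ sym)
    ≡⟨ FP.punchOut-punchIn v ⟩
      lookup σ x
    ∎
    where open ≡-Reasoning

module Deletion {m} (π : Word (suc m)) (π-perm : IsPerm π) (p : Fin (suc m)) where

  value-≢ : ∀ x → lookup π p ≢ lookup π (punchIn p x)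
  value-≢ x same = FP.punchInᵢ≢i p x (sym (π-perm _ _ same))

  lookup-delete : ∀ x → lookup (delete p π) x ≡ punchOut (value-≢ x)
  lookup-delete x = trans (VP.lookup∘tabulate _ x) (squeeze-≢ x (value-≢ x))

  delete-perm : IsPerm (delete p π)
  delete-perm x y same =
    FP.punchIn-injective p x y (π-perm _ _ (FP.punchOut-injective (value-≢ x) (value-≢ y)
      (trans (sym (lookup-delete x)) (trans same (lookup-delete y)))))

  insert-delete : insert p (lookup π p) (delete p π) ≡ π
  insert-delete = vec-ext λ q → at q (position-view p q)
    where
    at : ∀ q → (q ≡ p) ⊎ Σ (Fin m) (λ x → q ≡ punchIn p x) →
         lookup (insert p (lookup π p) (delete p π)) q ≡ lookup π q
    at q (inj₁ refl)       = lookup-insert-here p _ _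
    at q (inj₂ (x , refl)) =
      trans (lookup-insert-punchIn p _ _ x)
            (trans (cong (punchIn (lookup π p)) (lookup-delete x)) (FP.punchIn-punchOut (value-≢ x)))

-- A word of any length n is decreasing within the blocks of a when it
-- descends at every pair of adjacent positions of one block; for
-- n = size a this is DecrInBlocks a.
Decreasing : ∀ {k n} (a : Vec ℕ k) → Word n → Set
Decreasing {n = n} a π = ∀ (q q' : Fin n) → toℕ q' ≡ suc (toℕ q) →
  blockOf a (toℕ q) ≡ blockOf a (toℕ q') → lookup π q' Fin.< lookup π q

decreasing-in-block : ∀ {k n} (a : Vec ℕ k) (π : Word n) → Decreasing a π → ∀ {q q'} →
  toℕ q < toℕ q' → blockOf a (toℕ q) ≡ blockOf a (toℕ q') → lookup π q' Fin.< lookup π q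
decreasing-in-block {n = n} a π dec {q} {q'} q<q' same =
  descend (toℕ q' ∸ suc (toℕ q)) q' (sym (NP.m+[n∸m]≡n q<q')) same
  where
  descend : ∀ d q' → toℕ q' ≡ suc (toℕ q) + d → blockOf a (toℕ q) ≡ blockOf a (toℕ q') →
            lookup π q' Fin.< lookup π q
  descend zero    q' q'≡ same = dec q q' (trans q'≡ (cong suc (NP.+-identityʳ _))) same
  descend (suc d) q' q'≡ same =
    NP.<-trans (dec r q' (trans q'≡ (trans (NP.+-suc _ d) (cong suc (sym r≡)))) (trans (sym same-r) same))
               (descend d r r≡ same-r)
    where
    r< : suc (toℕ q) + d < n
    r< = NP.<-trans (subst (suc (toℕ q) + d <_) (sym (trans q'≡ (NP.+-suc _ d))) (NP.n<1+n _)) (FP.toℕ<n q')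
    r : Fin n
    r = Fin.fromℕ< r<
    r≡ : toℕ r ≡ suc (toℕ q) + d
    r≡ = FP.toℕ-fromℕ< r<
    same-r : blockOf a (toℕ q) ≡ blockOf a (toℕ r)
    same-r = blockOf-between a (subst (toℕ q ≤_) (sym r≡) (NP.≤-trans (NP.n≤1+n _) (NP.m≤m+n _ d)))
               (subst₂ _≤_ (sym r≡) (sym q'≡) (NP.+-monoʳ-≤ (suc (toℕ q)) (NP.n≤1+n d))) same

fixed-point-unique : ∀ {k n} (a : Vec ℕ k) (π : Word n) → Decreasing a π → ∀ q q' →
  lookup π q ≡ q → lookup π q' ≡ q' → blockOf a (toℕ q) ≡ blockOf a (toℕ q') → q ≡ q'
fixed-point-unique a π dec q q' fix fix' same with NP.<-cmp (toℕ q) (toℕ q')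
... | tri≈ _ q≡q' _ = FP.toℕ-injective q≡q'
... | tri< q<q' _ _ =
  ⊥-elim (NP.<-asym q<q' (subst₂ Fin._<_ fix' fix (decreasing-in-block a π dec q<q' same)))
... | tri> _ _ q>q' =
  ⊥-elim (NP.<-asym q>q' (subst₂ Fin._<_ fix fix' (decreasing-in-block a π dec q>q' (sym same))))

punchIn-adjacent : ∀ {m} (p : Fin (suc m)) (x x' : Fin m) →
  toℕ (punchIn p x') ≡ suc (toℕ (punchIn p x)) → toℕ x' ≡ suc (toℕ x)
punchIn-adjacent p x x' adj with toℕ x <? toℕ p | toℕ x' <? toℕ p
... | yes x<p | yes x'<p rewrite toℕ-punchIn-< p x x<p | toℕ-punchIn-< p x' x'<p = adj
... | yes x<p | no  x'≮p rewrite toℕ-punchIn-< p x x<p | toℕ-punchIn-≥ p x' (NP.≮⇒≥ x'≮p) =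
  ⊥-elim (x'≮p (subst (_< toℕ p) (sym (NP.suc-injective adj)) x<p))
... | no  x≮p | yes x'<p rewrite toℕ-punchIn-≥ p x (NP.≮⇒≥ x≮p) | toℕ-punchIn-< p x' x'<p =
  ⊥-elim (x≮p (NP.<-trans (subst (toℕ x <_) (sym adj) (NP.m<n⇒m<1+n (NP.n<1+n _))) x'<p))
... | no  x≮p | no  x'≮p rewrite toℕ-punchIn-≥ p x (NP.≮⇒≥ x≮p) | toℕ-punchIn-≥ p x' (NP.≮⇒≥ x'≮p) =
  NP.suc-injective adj

InsertionCondition : ∀ {k m} (a : Vec ℕ k) (i : Fin k) (p v : Fin (suc m)) → Word m → Set
InsertionCondition a i p v σ = ∀ x → blockOf (a ∸ᵥ basis i) (toℕ x) ≡ toℕ i →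
  (toℕ x < toℕ p → toℕ v ≤ toℕ (lookup σ x)) × (toℕ p ≤ toℕ x → toℕ (lookup σ x) < toℕ v)

module AtPosition {k} (a : Vec ℕ k) (i : Fin k) {m} (p : Fin (suc m))
  (start≤p : blockStart a i ≤ toℕ p) (p<end : toℕ p < blockStart a i + lookup a i) where

  a⁻ : Vec ℕ k
  a⁻ = a ∸ᵥ basis i

  p-in-block : blockOf a (toℕ p) ≡ toℕ i
  p-in-block = blockOf-≡ a i (toℕ p) start≤p p<end

  blockOf-punchIn : ∀ x → blockOf a⁻ (toℕ x) ≡ blockOf a (toℕ (punchIn p x))
  blockOf-punchIn x with toℕ x <? toℕ p
  ... | yes x<p = trans (proj₁ (blockOf-removal a i (toℕ p) start≤p p<end (toℕ x)) x<p)
                        (cong (blockOf a) (sym (toℕ-punchIn-< p x x<p)))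
  ... | no  x≮p = trans (proj₂ (blockOf-removal a i (toℕ p) start≤p p<end (toℕ x)) (NP.≮⇒≥ x≮p))
                        (cong (blockOf a) (sym (toℕ-punchIn-≥ p x (NP.≮⇒≥ x≮p))))

  delete-decreasing : ∀ (π : Word (suc m)) (π-perm : IsPerm π) → Decreasing a π → Decreasing a⁻ (delete p π)
  delete-decreasing π π-perm dec x x' adj same =
    subst₂ Fin._<_ (sym (lookup-delete x')) (sym (lookup-delete x))
      (punchOut-mono-< (value-≢ x') (value-≢ x)
        (decreasing-in-block a π dec
          (punchIn-mono-< p (subst (toℕ x <_) (sym adj) (NP.n<1+n _)))
          (trans (sym (blockOf-punchIn x)) (trans same (blockOf-punchIn x')))))
    where open Deletion π π-perm p

  module _ (v : Fin (suc m)) (σ : Word m) (dec : Decreasing a⁻ σ) (cond : InsertionCondition a i p v σ) where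

    private
      leaving-p : ∀ x' → toℕ (punchIn p x') ≡ suc (toℕ p) → blockOf a (toℕ p) ≡ blockOf a (toℕ (punchIn p x')) →
                  lookup (insert p v σ) (punchIn p x') Fin.< lookup (insert p v σ) p
      leaving-p x' adj same =
        subst₂ Fin._<_ (sym (lookup-insert-punchIn p v σ x')) (sym (lookup-insert-here p v σ))
          (subst (_< toℕ v) (sym (toℕ-punchIn-< v (lookup σ x') σx'<v)) σx'<v)
        where
        p≤x' : toℕ p ≤ toℕ x'
        p≤x' = NP.≮⇒≥ λ x'<p →
          NP.<-irrefl (sym (toℕ-punchIn-< p x' x'<p)) (NP.<-trans x'<p (subst (toℕ p <_) (sym adj) (NP.n<1+n _)))
        σx'<v : toℕ (lookup σ x') < toℕ v
        σx'<v = proj₂ (cond x' (trans (blockOf-punchIn x') (trans (sym same) p-in-block))) p≤x'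

      entering-p : ∀ x → toℕ p ≡ suc (toℕ (punchIn p x)) → blockOf a (toℕ (punchIn p x)) ≡ blockOf a (toℕ p) →
                   lookup (insert p v σ) p Fin.< lookup (insert p v σ) (punchIn p x)
      entering-p x adj same =
        subst₂ Fin._<_ (sym (lookup-insert-here p v σ)) (sym (lookup-insert-punchIn p v σ x))
          (subst (toℕ v <_) (sym (toℕ-punchIn-≥ v (lookup σ x) v≤σx)) (s≤s v≤σx))
        where
        x<p : toℕ x < toℕ p
        x<p = NP.≰⇒> λ p≤x → NP.<⇒≱ (subst (toℕ x <_) (sym (trans adj (cong suc (toℕ-punchIn-≥ p x p≤x))))
                                           (NP.m<n⇒m<1+n (NP.n<1+n _))) p≤x
        v≤σx : toℕ v ≤ toℕ (lookup σ x)
        v≤σx = proj₁ (cond x (trans (blockOf-punchIn x) (trans same p-in-block))) x<p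

    insert-decreasing : Decreasing a (insert p v σ)
    insert-decreasing q q' adj same with position-view p q | position-view p q'
    ... | inj₁ refl       | inj₁ refl        = ⊥-elim (NP.<-irrefl adj (NP.n<1+n _))
    ... | inj₁ refl       | inj₂ (x' , refl) = leaving-p x' adj same
    ... | inj₂ (x , refl) | inj₁ refl        = entering-p x adj same
    ... | inj₂ (x , refl) | inj₂ (x' , refl) =
      subst₂ Fin._<_ (sym (lookup-insert-punchIn p v σ x')) (sym (lookup-insert-punchIn p v σ x))
        (punchIn-mono-< v (dec x x' (punchIn-adjacent p x x' adj)
                                    (trans (blockOf-punchIn x) (trans same (sym (blockOf-punchIn x'))))))

-- Where a fixed point can be inserted into a decreasing block: an
-- abstract statement about a decreasing function f on an interval.

InInterval : ∀ {m} → ℕ → ℕ → Fin m → Set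
InInterval s L x = s ≤ toℕ x × toℕ x < s + L

Separates : ∀ {m} → (Fin m → ℕ) → ℕ → ℕ → ℕ → Set
Separates f s L P = ∀ x → InInterval s L x → (toℕ x < P → P ≤ f x) × (P ≤ toℕ x → f x < P)

widen : ∀ {m} {s L} {x : Fin m} → InInterval s L x → InInterval s (suc L) x
widen {s = s} {L} (s≤x , x<s+L) = s≤x , NP.<-trans x<s+L (NP.+-monoʳ-< s (NP.n<1+n L))

last-or-before : ∀ {m} {s L} {x : Fin m} → InInterval s (suc L) x → InInterval s L x ⊎ toℕ x ≡ s + L
last-or-before {s = s} {L} {x} (s≤x , x<end) with toℕ x <? s + L
... | yes x<s+L = inj₁ (s≤x , x<s+L)
... | no  x≮s+L = inj₂ (NP.≤-antisym (NP.≤-pred (subst (toℕ x <_) (NP.+-suc s L) x<end)) (NP.≮⇒≥ x≮s+L))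

module Extend {m} (f : Fin m → ℕ) s L (s+L<m : s + L < m)
  (decr : ∀ {x x'} → InInterval s (suc L) x → InInterval s (suc L) x' → toℕ x < toℕ x' → f x' < f x)
  (no-fix : ∀ {x} → InInterval s (suc L) x → f x ≢ toℕ x)
  (P : ℕ) (s≤P : s ≤ P) (P≤s+L : P ≤ s + L) (sep : Separates f s L P) where

  last : Fin m
  last = Fin.fromℕ< s+L<m

  toℕ-last : toℕ last ≡ s + L
  toℕ-last = FP.toℕ-fromℕ< s+L<m

  last∈ : InInterval s (suc L) last
  last∈ = subst (s ≤_) (sym toℕ-last) (NP.m≤m+n s L) , subst (_< s + suc L) (sym toℕ-last) (NP.+-monoʳ-< s (NP.n<1+n L))

  keep : f last < P → Separates f s (suc L) P
  keep f-last<P x x∈ with last-or-before x∈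
  ... | inj₁ old = sep x old
  ... | inj₂ x≡s+L rewrite FP.toℕ-injective {i = x} {j = last} (trans x≡s+L (sym toℕ-last)) =
    (λ last<P → ⊥-elim (NP.<⇒≱ last<P (subst (P ≤_) (sym toℕ-last) P≤s+L))) , (λ _ → f-last<P)

  step : P ≡ s + L → P < f last → Separates f s (suc L) (suc P)
  step P≡ P<f-last x x∈ with last-or-before x∈
  ... | inj₁ (s≤x , x<s+L) =
    (λ _ → NP.<-trans P<f-last (decr (widen (s≤x , x<s+L)) last∈ (subst (toℕ x <_) (sym toℕ-last) x<s+L))) ,
    (λ P+1≤x → ⊥-elim (NP.<⇒≱ (subst (toℕ x <_) (sym P≡) x<s+L) (NP.≤-trans (NP.n≤1+n P) P+1≤x)))
  ... | inj₂ x≡s+L rewrite FP.toℕ-injective {i = x} {j = last} (trans x≡s+L (sym toℕ-last)) =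
    (λ _ → P<f-last) , (λ P+1≤last → ⊥-elim (NP.<-irrefl (trans P≡ (sym toℕ-last)) P+1≤last))

  extended : Σ ℕ λ P' → s ≤ P' × P' ≤ s + suc L × Separates f s (suc L) P'
  extended with P <? s + L
  ... | yes P<s+L = P , s≤P , P≤s+L+1 , keep f-last<P
    where
    P≤s+L+1 : P ≤ s + suc L
    P≤s+L+1 = NP.≤-trans P≤s+L (NP.+-monoʳ-≤ s (NP.n≤1+n L))
    xP : Fin m
    xP = Fin.fromℕ< (NP.<-trans P<s+L s+L<m)
    toℕ-xP : toℕ xP ≡ P
    toℕ-xP = FP.toℕ-fromℕ< (NP.<-trans P<s+L s+L<m)
    xP∈ : InInterval s L xP
    xP∈ = subst (s ≤_) (sym toℕ-xP) s≤P , subst (_< s + L) (sym toℕ-xP) P<s+L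
    f-last<P : f last < P
    f-last<P = NP.<-trans (decr (widen xP∈) last∈ (subst₂ _<_ (sym toℕ-xP) (sym toℕ-last) P<s+L))
                          (proj₂ (sep xP xP∈) (NP.≤-reflexive (sym toℕ-xP)))
  ... | no P≮s+L with f last <? P
  ...   | yes f-last<P = P , s≤P , NP.≤-trans P≤s+L (NP.+-monoʳ-≤ s (NP.n≤1+n L)) , keep f-last<P
  ...   | no  f-last≮P = suc P , NP.m≤n⇒m≤1+n s≤P , subst (suc P ≤_) (sym (NP.+-suc s L)) (s≤s P≤s+L) ,
                         step P≡s+L P<f-last
    where
    P≡s+L : P ≡ s + L
    P≡s+L = NP.≤-antisym P≤s+L (NP.≮⇒≥ P≮s+L)
    P<f-last : P < f last
    P<f-last = NP.≤∧≢⇒< (NP.≮⇒≥ f-last≮P) (λ P≡f → no-fix last∈ (trans (sym P≡f) (trans P≡s+L (sym toℕ-last))))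

-- A strictly decreasing f without fixed points on [s, s + L) has a
-- separating point in [s, s + L]: the first x with f x < x, if any.
separating-point : ∀ {m} (f : Fin m → ℕ) s L → s + L ≤ m →
  (∀ {x x'} → InInterval s L x → InInterval s L x' → toℕ x < toℕ x' → f x' < f x) →
  (∀ {x} → InInterval s L x → f x ≢ toℕ x) →
  Σ ℕ λ P → s ≤ P × P ≤ s + L × Separates f s L P
separating-point f s zero _ _ _ =
  s , NP.≤-refl , NP.m≤m+n s 0 ,
  λ x (s≤x , x<s+0) → ⊥-elim (NP.<⇒≱ x<s+0 (subst (_≤ toℕ x) (sym (NP.+-identityʳ s)) s≤x))
separating-point {m} f s (suc L) s+L+1≤m decr no-fix
  with separating-point f s L (NP.≤-trans (NP.+-monoʳ-≤ s (NP.n≤1+n L)) s+L+1≤m)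
         (λ x∈ x'∈ → decr (widen x∈) (widen x'∈)) (λ x∈ → no-fix (widen x∈))
... | P , s≤P , P≤s+L , sep =
  Extend.extended f s L (subst (_≤ m) (NP.+-suc s L) s+L+1≤m) decr no-fix P s≤P P≤s+L sep

-- Two separating points in [s, s + L] coincide: if P < P', the value at
-- position P would be both ≥ P' and < P.
private
  not-before : ∀ {m} (f : Fin m → ℕ) s L → s + L ≤ m → ∀ {P P'} →
    s ≤ P → Separates f s L P → P < P' → P' ≤ s + L → Separates f s L P' → ⊥
  not-before {m} f s L s+L≤m {P} {P'} s≤P sep P<P' P'≤ sep' =
    NP.<-irrefl refl (NP.<-trans (NP.≤-<-trans P'≤fx fx<P) P<P')
    where
    P<m : P < m
    P<m = NP.<-≤-trans P<P' (NP.≤-trans P'≤ s+L≤m)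
    x : Fin m
    x = Fin.fromℕ< P<m
    toℕ-x : toℕ x ≡ P
    toℕ-x = FP.toℕ-fromℕ< P<m
    x∈ : InInterval s L x
    x∈ = subst (s ≤_) (sym toℕ-x) s≤P , subst (_< s + L) (sym toℕ-x) (NP.<-≤-trans P<P' P'≤)
    P'≤fx : P' ≤ f x
    P'≤fx = proj₁ (sep' x x∈) (subst (_< P') (sym toℕ-x) P<P')
    fx<P : f x < P
    fx<P = proj₂ (sep x x∈) (NP.≤-reflexive (sym toℕ-x))

separating-point-unique : ∀ {m} (f : Fin m → ℕ) s L → s + L ≤ m → ∀ {P P'} →
  s ≤ P → P ≤ s + L → Separates f s L P → s ≤ P' → P' ≤ s + L → Separates f s L P' → P ≡ P'
separating-point-unique f s L s+L≤m {P} {P'} s≤P P≤ sep s≤P' P'≤ sep' with NP.<-cmp P P'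
... | tri≈ _ P≡P' _ = P≡P'
... | tri< P<P' _ _ = ⊥-elim (not-before f s L s+L≤m s≤P  sep  P<P' P'≤ sep')
... | tri> _ _ P'<P = ⊥-elim (not-before f s L s+L≤m s≤P' sep' P'<P P≤  sep)

countWords : ∀ n {p} {P : Word n → Set p} → Decidable P → ℕ
countWords n P? = length (filter P? (allWords n n))

countWords-bij : ∀ n m {p q} {P : Word n → Set p} {Q : Word m → Set q} (P? : Decidable P) (Q? : Decidable Q)
  (f : Word n → Word m) (g : Word m → Word n) → (∀ {π} → P π → Q (f π)) → (∀ {σ} → Q σ → P (g σ)) →
  (∀ {π} → P π → g (f π) ≡ π) → (∀ {σ} → Q σ → f (g σ) ≡ σ) → countWords n P? ≡ countWords m Q?
countWords-bij n m P? Q? f g P⇒Qf Q⇒Pg gf fg = NP.≤-antisym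
  (count-≤ P? Q? f g P⇒Qf gf (allWords n n) (allWords m m) (allWords-unique n n) (allWords-complete m m))
  (count-≤ Q? P? g f Q⇒Pg fg (allWords m m) (allWords n n) (allWords-unique m m) (allWords-complete n n))

FixFreeIn : ∀ {k n} → List ℕ → Vec ℕ k → Word n → Set
FixFreeIn js a π = ∀ q → blockOf a (toℕ q) ∈ js → lookup π q ≢ q

Admissible : ∀ {k n} → List ℕ → Vec ℕ k → Word n → Set
Admissible js a π = IsPerm π × Decreasing a π × FixFreeIn js a π

Admissible? : ∀ {k n} (js : List ℕ) (a : Vec ℕ k) → Decidable (Admissible {n = n} js a)
Admissible? js a π =
  FP.all? (λ q → FP.all? (λ q' → (lookup π q Fin.≟ lookup π q') →-dec (q Fin.≟ q')))
  ×-dec FP.all? (λ q → FP.all? (λ q' → (toℕ q' ℕ.≟ suc (toℕ q)) →-dec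
                         ((blockOf a (toℕ q) ℕ.≟ blockOf a (toℕ q')) →-dec (lookup π q' Fin.<? lookup π q))))
  ×-dec FP.all? (λ q → (blockOf a (toℕ q) ∈? js) →-dec ¬? (lookup π q Fin.≟ q))

count : ∀ {k} → List ℕ → Vec ℕ k → ℕ
count js a = countWords (size a) (Admissible? js a)

firstBlocks : ℕ → ℕ → List ℕ
firstBlocks k j = map toℕ (firstIndices k j)

∈-firstBlocks : ∀ {k j t} → j ≤ k → (t ∈ firstBlocks k j → t < j) × (t < j → t ∈ firstBlocks k j)
∈-firstBlocks {k} {j} {t} j≤k = member⇒< , <⇒member
  where
  member⇒< : t ∈ firstBlocks k j → t < j
  member⇒< t∈ with ∈-map⁻ toℕ t∈
  ... | i , i∈ , refl = proj₂ (∈-filter⁻ (λ i → toℕ i <? j) {xs = allFin k} i∈)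
  <⇒member : t < j → t ∈ firstBlocks k j
  <⇒member t<j = subst (_∈ firstBlocks k j) (FP.toℕ-fromℕ< t<k)
    (∈-map⁺ toℕ (∈-filter⁺ (λ i → toℕ i <? j) (∈-allFin (Fin.fromℕ< t<k))
                            (subst (_< j) (sym (FP.toℕ-fromℕ< t<k)) t<j)))
    where
    t<k : t < k
    t<k = NP.<-≤-trans t<j j≤k

countD≡count : ∀ {k} j → j ≤ k → (a : Vec ℕ k) → countD j a ≡ count (firstBlocks k j) a
countD≡count j j≤k a = count-≐ (InD? j a) (Admissible? _ a)
  (λ (perm , dec , fixFree) → perm , dec , λ q q∈ → fixFree q (proj₁ (∈-firstBlocks j≤k) q∈))
  (λ (perm , dec , fixFree) → perm , dec , λ q q<j → fixFree q (proj₂ (∈-firstBlocks j≤k) q<j))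
  (allWords (size a) (size a))

-- Recurrence for forbidding fixed points in one more block i:
--   #(no fixed points in js) = #(none in i, js) + #(none in js, one in i),
-- and the last set is in bijection with the admissible permutations for
-- (i ∷ js) of the composition with block i shortened by one: delete the
-- fixed point, or insert one at the unique possible place.

HasFixIn : ∀ {k n} (b : Vec ℕ k) (i : Fin k) → Word n → Set
HasFixIn {n = n} b i π = ∃ λ (q : Fin n) → blockOf b (toℕ q) ≡ toℕ i × lookup π q ≡ q

HasFixIn? : ∀ {k n} (b : Vec ℕ k) (i : Fin k) → Decidable (HasFixIn {n = n} b i)
HasFixIn? b i π = FP.any? (λ q → (blockOf b (toℕ q) ℕ.≟ toℕ i) ×-dec (lookup π q Fin.≟ q))

WithFixIn : ∀ {k n} → List ℕ → (b : Vec ℕ k) (i : Fin k) → Word n → Set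
WithFixIn js b i π = Admissible js b π × HasFixIn b i π

WithFixIn? : ∀ {k n} js (b : Vec ℕ k) (i : Fin k) → Decidable (WithFixIn {n = n} js b i)
WithFixIn? js b i π = Admissible? js b π ×-dec HasFixIn? b i π

count-split : ∀ {k} js (b : Vec ℕ k) (i : Fin k) →
  count js b ≡ count (toℕ i ∷ js) b + countWords (size b) (WithFixIn? js b i)
count-split js b i = count-⊎ (Admissible? js b) (Admissible? (toℕ i ∷ js) b) (WithFixIn? js b i)
  (λ {π} → fix-in-i-or-not {π})
  (λ (perm , dec , fixFree) → perm , dec , λ q q∈js → fixFree q (there q∈js))
  proj₁
  (λ (_ , _ , fixFree) (_ , q , q-in-i , fix) → fixFree q (here q-in-i) fix)
  (allWords (size b) (size b))
  where
  fix-in-i-or-not : ∀ {π} → Admissible js b π → Admissible (toℕ i ∷ js) b π ⊎ WithFixIn js b i π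
  fix-in-i-or-not {π} adm@(perm , dec , fixFree) with HasFixIn? b i π
  ... | yes fix-in-i = inj₂ (adm , fix-in-i)
  ... | no  no-fix   = inj₁ (perm , dec , fixFree')
    where
    fixFree' : FixFreeIn (toℕ i ∷ js) b π
    fixFree' q (here q-in-i) fix = no-fix (q , q-in-i , fix)
    fixFree' q (there q∈js)  fix = fixFree q q∈js fix

count-fix-in-empty-block : ∀ {k} js (b : Vec ℕ k) (i : Fin k) → ¬ 1 ≤ lookup b i →
  countWords (size b) (WithFixIn? js b i) ≡ 0
count-fix-in-empty-block js b i empty = count-none (WithFixIn? js b i) no-position (allWords (size b) (size b))
  where
  no-position : ∀ π → ¬ WithFixIn js b i π
  no-position π (_ , q , q-in-i , _) =
    let (start≤q , q<end) = blockOf-bounds b i (toℕ q) q-in-i in empty (nonempty-block b i start≤q q<end)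

-- The point of a decided existence claim over positions, or 0 if there is none.
pointOf : ∀ {n p} {P : Fin (suc n) → Set p} → Dec (∃ P) → Fin (suc n)
pointOf (yes (q , _)) = q
pointOf (no  _)       = Fin.zero

module NonemptyBlock {k} (js : List ℕ) (i : Fin k) (i∉js : toℕ i ∉ js) (b : Vec ℕ k)
  (nonempty : 1 ≤ lookup b i) {m} (size⁻ : size (b ∸ᵥ basis i) ≡ m) where

  b⁻ : Vec ℕ k
  b⁻ = b ∸ᵥ basis i
  s L : ℕ
  s = blockStart b i
  L = lookup b i ∸ 1

  size-b : size b ≡ suc m
  size-b = trans (size-removal b i nonempty) (cong suc size⁻)

  end : s + lookup b i ≡ suc (s + L)
  end = trans (cong (s ℕ.+_) (sym (NP.m∸n+n≡m nonempty))) (trans (sym (NP.+-assoc s L 1)) (NP.+-comm (s + L) 1))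

  s+L≤m : s + L ≤ m
  s+L≤m = subst₂ _≤_ (cong₂ _+_ (blockStart-removal b i) (lookup-removal b i)) size⁻ (blockEnd≤size b⁻ i)

  in-block⁻ : ∀ (x : Fin m) → blockOf b⁻ (toℕ x) ≡ toℕ i → InInterval s L x
  in-block⁻ x x-in-i =
    let (start≤x , x<end) = blockOf-bounds b⁻ i (toℕ x) x-in-i
    in subst (_≤ toℕ x) (blockStart-removal b i) start≤x ,
       subst (toℕ x <_) (cong₂ _+_ (blockStart-removal b i) (lookup-removal b i)) x<end

  in-block⁻-≡ : ∀ (x : Fin m) → InInterval s L x → blockOf b⁻ (toℕ x) ≡ toℕ i
  in-block⁻-≡ x (s≤x , x<s+L) =
    blockOf-≡ b⁻ i (toℕ x) (subst (_≤ toℕ x) (sym (blockStart-removal b i)) s≤x)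
                           (subst (toℕ x <_) (sym (cong₂ _+_ (blockStart-removal b i) (lookup-removal b i))) x<s+L)

  -- P is a place where a fixed point can be inserted into σ.
  Good : Word m → Fin (suc m) → Set
  Good σ P = s ≤ toℕ P × toℕ P ≤ s + L × Separates (toℕ ∘ lookup σ) s L (toℕ P)

  Good? : ∀ σ → Decidable (Good σ)
  Good? σ P = (s ℕ.≤? toℕ P) ×-dec (toℕ P ℕ.≤? s + L) ×-dec
    FP.all? (λ x → ((s ℕ.≤? toℕ x) ×-dec (toℕ x <? s + L)) →-dec
      (((toℕ x <? toℕ P) →-dec (toℕ P ℕ.≤? toℕ (lookup σ x))) ×-dec
       ((toℕ P ℕ.≤? toℕ x) →-dec (toℕ (lookup σ x) <? toℕ P))))

  good-unique : ∀ σ {P P'} → Good σ P → Good σ P' → P ≡ P'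
  good-unique σ (s≤P , P≤ , sep) (s≤P' , P'≤ , sep') =
    FP.toℕ-injective (separating-point-unique (toℕ ∘ lookup σ) s L s+L≤m s≤P P≤ sep s≤P' P'≤ sep')

  good-exists : ∀ σ → Admissible (toℕ i ∷ js) b⁻ σ → ∃ (Good σ)
  good-exists σ (_ , dec , fixFree) with separating-point (toℕ ∘ lookup σ) s L s+L≤m decr no-fix
    where
    decr : ∀ {x x'} → InInterval s L x → InInterval s L x' → toℕ x < toℕ x' → toℕ (lookup σ x') < toℕ (lookup σ x)
    decr {x} {x'} x∈ x'∈ x<x' =
      decreasing-in-block b⁻ σ dec x<x' (trans (in-block⁻-≡ x x∈) (sym (in-block⁻-≡ x' x'∈)))
    no-fix : ∀ {x} → InInterval s L x → toℕ (lookup σ x) ≢ toℕ x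
    no-fix {x} x∈ = fixFree x (here (in-block⁻-≡ x x∈)) ∘ FP.toℕ-injective
  ... | P , s≤P , P≤ , sep =
    Fin.fromℕ< P<m+1 , subst (s ≤_) (sym toℕ-P) s≤P , subst (_≤ s + L) (sym toℕ-P) P≤ ,
    subst (Separates (toℕ ∘ lookup σ) s L) (sym toℕ-P) sep
    where
    P<m+1 : P < suc m
    P<m+1 = s≤s (NP.≤-trans P≤ s+L≤m)
    toℕ-P : toℕ (Fin.fromℕ< P<m+1) ≡ P
    toℕ-P = FP.toℕ-fromℕ< P<m+1

  module DeleteFix (π : Word (suc m)) (perm : IsPerm π) (dec : Decreasing b π)
                   (q : Fin (suc m)) (q-in-i : blockOf b (toℕ q) ≡ toℕ i) (fix : lookup π q ≡ q) where

    open Deletion π perm q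
    bounds : s ≤ toℕ q × toℕ q < s + lookup b i
    bounds = blockOf-bounds b i (toℕ q) q-in-i
    open AtPosition b i q (proj₁ bounds) (proj₂ bounds)

    fixed-point-lifts : ∀ x → lookup (delete q π) x ≡ x → lookup π (punchIn q x) ≡ punchIn q x
    fixed-point-lifts x σx≡x =
      begin
        lookup π (punchIn q x)                        ≡⟨ sym (FP.punchIn-punchOut (value-≢ x)) ⟩
        punchIn (lookup π q) (punchOut (value-≢ x))   ≡⟨ cong (punchIn (lookup π q)) (sym (lookup-delete x)) ⟩
        punchIn (lookup π q) (lookup (delete q π) x)  ≡⟨ cong₂ punchIn fix σx≡x ⟩
        punchIn q x                                   ∎
      where open ≡-Reasoning

    deleted-admissible : FixFreeIn js b π → Admissible (toℕ i ∷ js) b⁻ (delete q π)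
    deleted-admissible fixFree = delete-perm , delete-decreasing π perm dec , fixFree⁻
      where
      fixFree⁻ : FixFreeIn (toℕ i ∷ js) b⁻ (delete q π)
      fixFree⁻ x (here x-in-i) σx≡x =
        FP.punchInᵢ≢i q x (fixed-point-unique b π dec _ q (fixed-point-lifts x σx≡x) fix
                             (trans (sym (blockOf-punchIn x)) (trans x-in-i (sym q-in-i))))
      fixFree⁻ x (there x∈js) σx≡x =
        fixFree (punchIn q x) (subst (_∈ js) (blockOf-punchIn x) x∈js) (fixed-point-lifts x σx≡x)

    deleted-good : Good (delete q π) q
    deleted-good = proj₁ bounds , NP.≤-pred (subst (toℕ q <_) end (proj₂ bounds)) , separates
      where
      separates : Separates (toℕ ∘ lookup (delete q π)) s L (toℕ q)
      separates x x∈ = before , after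
        where
        same-block : blockOf b (toℕ (punchIn q x)) ≡ blockOf b (toℕ q)
        same-block = trans (sym (blockOf-punchIn x)) (trans (in-block⁻-≡ x x∈) (sym q-in-i))
        y : Fin (suc m)
        y = lookup π (punchIn q x)
        before : toℕ x < toℕ q → toℕ q ≤ toℕ (lookup (delete q π) x)
        before x<q = subst (toℕ q ≤_) (cong toℕ (sym (lookup-delete x)))
                       (NP.≤-pred (subst (toℕ q <_) (sym (toℕ-punchOut-> (value-≢ x) q<y)) q<y′))
          where
          q<y : lookup π q Fin.< y
          q<y = decreasing-in-block b π dec (subst (_< toℕ q) (sym (toℕ-punchIn-< q x x<q)) x<q) same-block
          q<y′ : toℕ q < toℕ y
          q<y′ = subst (λ v → toℕ v < toℕ y) fix q<y
        after : toℕ q ≤ toℕ x → toℕ (lookup (delete q π) x) < toℕ q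
        after q≤x = subst (_< toℕ q) (cong toℕ (sym (lookup-delete x)))
                      (subst (_< toℕ q) (sym (toℕ-punchOut-< (value-≢ x) y<q)) (subst (λ v → toℕ y < toℕ v) fix y<q))
          where
          y<q : y Fin.< lookup π q
          y<q = decreasing-in-block b π dec (subst (toℕ q <_) (sym (toℕ-punchIn-≥ q x q≤x)) (s≤s q≤x)) (sym same-block)

  module InsertFix (σ : Word m) (adm : Admissible (toℕ i ∷ js) b⁻ σ) (P : Fin (suc m)) (good : Good σ P) where

    s≤P : s ≤ toℕ P
    s≤P = proj₁ good
    P<end : toℕ P < s + lookup b i
    P<end = subst (toℕ P <_) (sym end) (s≤s (proj₁ (proj₂ good)))
    open AtPosition b i P s≤P P<end

    condition : InsertionCondition b i P P σ
    condition x x-in-i = proj₂ (proj₂ good) x (in-block⁻ x x-in-i)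

    inserted-decreasing : Decreasing b (insert P P σ)
    inserted-decreasing = insert-decreasing P σ (proj₁ (proj₂ adm)) condition

    inserted-fix : HasFixIn b i (insert P P σ)
    inserted-fix = P , p-in-block , lookup-insert-here P P σ

    inserted-admissible : Admissible js b (insert P P σ)
    inserted-admissible = insert-perm P P σ (proj₁ adm) , inserted-decreasing , fixFree
      where
      fixFree : FixFreeIn js b (insert P P σ)
      fixFree q q∈js with position-view P q
      ... | inj₁ refl       = λ _ → i∉js (subst (_∈ js) p-in-block q∈js)
      ... | inj₂ (x , refl) = λ fix →
        proj₂ (proj₂ adm) x (there (subst (_∈ js) (sym (blockOf-punchIn x)) q∈js))
          (FP.punchIn-injective P _ _ (trans (sym (lookup-insert-punchIn P P σ x)) fix))

  -- The bijection: delete the fixed point of block i, or insert one at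
  -- the good place (positions default to 0 where none exists).
  removeFix : Word (suc m) → Word m
  removeFix π = delete (pointOf (HasFixIn? b i π)) π

  addFix : Word m → Word (suc m)
  addFix σ = insert (pointOf (FP.any? (Good? σ))) (pointOf (FP.any? (Good? σ))) σ

  private
    removeFix-admissible : ∀ π (d : Dec (HasFixIn b i π)) → WithFixIn js b i π →
                           Admissible (toℕ i ∷ js) b⁻ (delete (pointOf d) π)
    removeFix-admissible π (yes (q , q-in-i , fix)) ((perm , dec , fixFree) , _) =
      DeleteFix.deleted-admissible π perm dec q q-in-i fix fixFree
    removeFix-admissible π (no no-fix) (_ , has-fix) = ⊥-elim (no-fix has-fix)

    addFix-withFix : ∀ σ (d : Dec (∃ (Good σ))) → Admissible (toℕ i ∷ js) b⁻ σ →
                     WithFixIn js b i (insert (pointOf d) (pointOf d) σ)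
    addFix-withFix σ (yes (P , good)) adm = inserted-admissible , inserted-fix
      where open InsertFix σ adm P good
    addFix-withFix σ (no no-good) adm = ⊥-elim (no-good (good-exists σ adm))

    add-remove : ∀ π (d : Dec (HasFixIn b i π)) (d' : Dec (∃ (Good (delete (pointOf d) π)))) →
                 WithFixIn js b i π → insert (pointOf d') (pointOf d') (delete (pointOf d) π) ≡ π
    add-remove π (yes (q , q-in-i , fix)) (yes (P , good)) ((perm , dec , _) , _) =
      begin
        insert P P (delete q π)                ≡⟨ cong (λ P → insert P P (delete q π)) P≡q ⟩
        insert q q (delete q π)                ≡⟨ cong (λ v → insert q v (delete q π)) (sym fix) ⟩
        insert q (lookup π q) (delete q π)     ≡⟨ Deletion.insert-delete π perm q ⟩
        π                                      ∎
      where
      open ≡-Reasoning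
      P≡q : P ≡ q
      P≡q = good-unique (delete q π) good (DeleteFix.deleted-good π perm dec q q-in-i fix)
    add-remove π (yes (q , q-in-i , fix)) (no no-good) ((perm , dec , _) , _) =
      ⊥-elim (no-good (q , DeleteFix.deleted-good π perm dec q q-in-i fix))
    add-remove π (no no-fix) _ (_ , has-fix) = ⊥-elim (no-fix has-fix)

    remove-add : ∀ σ (d : Dec (∃ (Good σ))) (d' : Dec (HasFixIn b i (insert (pointOf d) (pointOf d) σ))) →
                 Admissible (toℕ i ∷ js) b⁻ σ → delete (pointOf d') (insert (pointOf d) (pointOf d) σ) ≡ σ
    remove-add σ (yes (P , good)) (yes (q , q-in-i , fix)) adm =
      trans (cong (λ q → delete q (insert P P σ)) q≡P) (delete-insert P P σ)
      where
      open InsertFix σ adm P good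
      q≡P : q ≡ P
      q≡P = fixed-point-unique b (insert P P σ) inserted-decreasing q P fix (lookup-insert-here P P σ)
              (trans q-in-i (sym (proj₁ (proj₂ inserted-fix))))
    remove-add σ (yes (P , good)) (no no-fix) adm = ⊥-elim (no-fix (InsertFix.inserted-fix σ adm P good))
    remove-add σ (no no-good) _ adm = ⊥-elim (no-good (good-exists σ adm))

  count-with-fix : countWords (size b) (WithFixIn? js b i) ≡ count (toℕ i ∷ js) b⁻
  count-with-fix =
    begin
      countWords (size b) (WithFixIn? js b i)
    ≡⟨ cong (λ n → countWords n (WithFixIn? js b i)) size-b ⟩
      countWords (suc m) (WithFixIn? js b i)
    ≡⟨ countWords-bij (suc m) m (WithFixIn? js b i) (Admissible? (toℕ i ∷ js) b⁻) removeFix addFix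
         (λ {π} → removeFix-admissible π (HasFixIn? b i π)) (λ {σ} → addFix-withFix σ (FP.any? (Good? σ)))
         (λ {π} → add-remove π (HasFixIn? b i π) (FP.any? (Good? (removeFix π))))
         (λ {σ} → remove-add σ (FP.any? (Good? σ)) (HasFixIn? b i (addFix σ))) ⟩
      countWords m (Admissible? (toℕ i ∷ js) b⁻)
    ≡⟨ cong (λ n → countWords n (Admissible? (toℕ i ∷ js) b⁻)) (sym size⁻) ⟩
      count (toℕ i ∷ js) b⁻
    ∎
    where open ≡-Reasoning

count-add-block : ∀ {k} js (i : Fin k) → toℕ i ∉ js → ∀ b →
  count js b ≡ count (toℕ i ∷ js) b + (if 1 ℕ.≤ᵇ lookup b i then count (toℕ i ∷ js) (b ∸ᵥ basis i) else 0)
count-add-block js i i∉js b with 1 ℕ.≤? lookup b i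
... | yes nonempty rewrite ≤ᵇ-true nonempty =
  trans (count-split js b i) (cong (count (toℕ i ∷ js) b ℕ.+_) (NonemptyBlock.count-with-fix js i i∉js b nonempty refl))
... | no  empty    rewrite ≤ᵇ-false empty =
  trans (count-split js b i) (cong (count (toℕ i ∷ js) b ℕ.+_) (count-fix-in-empty-block js b i empty))

-- Recurrence for S_b: the largest value of π ∈ S_b, |b| = m + 1, sits
-- at the start of its block i, and deleting it is a bijection onto
-- S_{b - e_i}.

hits-max : ∀ {m} (π : Word (suc m)) → IsPerm π → ∃ λ q → lookup π q ≡ Fin.fromℕ m
hits-max {m} π perm with FP.any? (λ q → lookup π q Fin.≟ Fin.fromℕ m)
... | yes hit = hit
... | no  miss = ⊥-elim (NP.<-irrefl refl (FP.injective⇒≤ {f = squeezed} squeezed-injective))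
  where
  max-≢ : ∀ q → Fin.fromℕ m ≢ lookup π q
  max-≢ q max≡ = miss (q , sym max≡)
  squeezed : Fin (suc m) → Fin m
  squeezed q = punchOut (max-≢ q)
  squeezed-injective : ∀ {q q'} → squeezed q ≡ squeezed q' → q ≡ q'
  squeezed-injective {q} {q'} same = perm q q' (FP.punchOut-injective (max-≢ q) (max-≢ q') same)

MaxIn : ∀ {k m} (b : Vec ℕ k) (i : Fin k) → Word (suc m) → Set
MaxIn {m = m} b i π = ∃ λ q → blockOf b (toℕ q) ≡ toℕ i × lookup π q ≡ Fin.fromℕ m

MaxInBlock : ∀ {k m} (b : Vec ℕ k) (i : Fin k) → Word (suc m) → Set
MaxInBlock b i π = Admissible [] b π × MaxIn b i π

MaxInBlock? : ∀ {k m} (b : Vec ℕ k) (i : Fin k) → Decidable (MaxInBlock {m = m} b i)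
MaxInBlock? b i π = Admissible? [] b π ×-dec
  FP.any? (λ q → (blockOf b (toℕ q) ℕ.≟ toℕ i) ×-dec (lookup π q Fin.≟ Fin.fromℕ _))

count-by-max : ∀ {k m} (b : Vec ℕ k) → size b ≡ suc m →
  count [] b ≡ sum (map (λ i → countWords (suc m) (MaxInBlock? b i)) (allFin k))
count-by-max {k} {m} b size-b =
  trans (cong (λ n → countWords n (Admissible? [] b)) size-b)
        (count-partition (Admissible? [] b) (MaxInBlock? b) proj₁ (λ {π} → max-somewhere {π})
                         (λ {i} {i'} {π} → max-unique {i} {i'} {π}) (allWords (suc m) (suc m)))
  where
  max-somewhere : ∀ {π} → Admissible [] b π → ∃ λ i → MaxInBlock b i π
  max-somewhere {π} adm@(perm , _) =
    let (q , max) = hits-max π perm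
        (i , q-in-i) = blockOf-exists b (toℕ q) (subst (toℕ q <_) (sym size-b) (FP.toℕ<n q))
    in i , adm , q , q-in-i , max
  max-unique : ∀ {i i' π} → MaxInBlock b i π → MaxInBlock b i' π → i ≡ i'
  max-unique ((perm , _) , q , q-in-i , max) (_ , q' , q'-in-i' , max')
    with perm q q' (trans max (sym max'))
  ... | refl = FP.toℕ-injective (trans (sym q-in-i) q'-in-i')

count-max-in-empty-block : ∀ {k m} (b : Vec ℕ k) (i : Fin k) → ¬ 1 ≤ lookup b i →
  countWords (suc m) (MaxInBlock? b i) ≡ 0
count-max-in-empty-block {m = m} b i empty = count-none (MaxInBlock? b i) no-position (allWords (suc m) (suc m))
  where
  no-position : ∀ π → ¬ MaxInBlock b i π
  no-position π (_ , q , q-in-i , _) =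
    let (start≤q , q<end) = blockOf-bounds b i (toℕ q) q-in-i in empty (nonempty-block b i start≤q q<end)

module MaxInNonemptyBlock {k} (b : Vec ℕ k) (i : Fin k) (nonempty : 1 ≤ lookup b i) {m}
  (size⁻ : size (b ∸ᵥ basis i) ≡ m) where

  b⁻ : Vec ℕ k
  b⁻ = b ∸ᵥ basis i
  s : ℕ
  s = blockStart b i
  max : Fin (suc m)
  max = Fin.fromℕ m

  s<m+1 : s < suc m
  s<m+1 = subst (s <_) (trans (size-removal b i nonempty) (cong suc size⁻))
                (NP.<-≤-trans (NP.m<m+n s nonempty) (blockEnd≤size b i))

  start : Fin (suc m)
  start = Fin.fromℕ< s<m+1

  toℕ-start : toℕ start ≡ s
  toℕ-start = FP.toℕ-fromℕ< s<m+1

  open AtPosition b i start (NP.≤-reflexive (sym toℕ-start))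
                            (subst (_< s + lookup b i) (sym toℕ-start) (NP.m<m+n s nonempty))

  max-at-start : ∀ {π} → MaxInBlock b i π → lookup π start ≡ max
  max-at-start {π} ((_ , dec , _) , q , q-in-i , π-q) with toℕ start NP.<? toℕ q
  ... | no  start≮q = subst (λ r → lookup π r ≡ max) q≡start π-q
    where
    q≡start : q ≡ start
    q≡start = FP.toℕ-injective (NP.≤-antisym (NP.≮⇒≥ start≮q)
                (subst (_≤ toℕ q) (sym toℕ-start) (proj₁ (blockOf-bounds b i (toℕ q) q-in-i))))
  ... | yes start<q = ⊥-elim (NP.<⇒≱ (subst (λ v → toℕ v < toℕ (lookup π start)) π-q
                                (decreasing-in-block b π dec start<q (trans p-in-block (sym q-in-i))))
                             (subst (toℕ (lookup π start) ≤_) (sym (FP.toℕ-fromℕ m)) (NP.≤-pred (FP.toℕ<n _))))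

  condition : ∀ σ → InsertionCondition b i start max σ
  condition σ x x-in-i = before , after
    where
    before : toℕ x < toℕ start → toℕ max ≤ toℕ (lookup σ x)
    before x<start = ⊥-elim (NP.<⇒≱ x<start (subst₂ _≤_ (trans (blockStart-removal b i) (sym toℕ-start)) refl
                                                     (proj₁ (blockOf-bounds b⁻ i (toℕ x) x-in-i))))
    after : toℕ start ≤ toℕ x → toℕ (lookup σ x) < toℕ max
    after _ = subst (toℕ (lookup σ x) <_) (sym (FP.toℕ-fromℕ m)) (FP.toℕ<n (lookup σ x))

  count-max-in-block : countWords (suc m) (MaxInBlock? b i) ≡ count [] b⁻
  count-max-in-block =
    trans (countWords-bij (suc m) m (MaxInBlock? b i) (Admissible? [] b⁻) (delete start) (insert start max)
            (λ {π} → deleted-admissible {π}) (λ {σ} → inserted-max-in-block {σ})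
            (λ {π} maxIn → trans (cong (λ v → insert start v (delete start π)) (sym (max-at-start {π} maxIn)))
                                 (Deletion.insert-delete π (proj₁ (proj₁ maxIn)) start))
            (λ {σ} _ → delete-insert start max σ))
          (cong (λ n → countWords n (Admissible? [] b⁻)) (sym size⁻))
    where
    deleted-admissible : ∀ {π} → MaxInBlock b i π → Admissible [] b⁻ (delete start π)
    deleted-admissible {π} ((perm , dec , _) , _) =
      Deletion.delete-perm π perm start , delete-decreasing π perm dec , λ _ ()
    inserted-max-in-block : ∀ {σ} → Admissible [] b⁻ σ → MaxInBlock b i (insert start max σ)
    inserted-max-in-block {σ} (perm , dec , _) =
      (insert-perm start max σ perm , insert-decreasing max σ dec (condition σ) , λ _ ()) ,
      start , p-in-block , lookup-insert-here start max σ

count-remove-max : ∀ {k m} (b : Vec ℕ k) → size b ≡ suc m →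
  count [] b ≡ sum (map (λ i → if 1 ℕ.≤ᵇ lookup b i then count [] (b ∸ᵥ basis i) else 0) (allFin k))
count-remove-max {k} {m} b size-b =
  trans (count-by-max b size-b) (cong sum (LP.map-cong by-block (allFin k)))
  where
  by-block : ∀ i → countWords (suc m) (MaxInBlock? b i) ≡ (if 1 ℕ.≤ᵇ lookup b i then count [] (b ∸ᵥ basis i) else 0)
  by-block i with 1 ℕ.≤? lookup b i
  ... | yes nonempty rewrite ≤ᵇ-true nonempty =
    MaxInNonemptyBlock.count-max-in-block b i nonempty {m}
      (NP.suc-injective (trans (sym (size-removal b i nonempty)) size-b))
  ... | no  empty    rewrite ≤ᵇ-false empty = count-max-in-empty-block {m = m} b i empty

count-empty : ∀ {k} (b : Vec ℕ k) → size b ≡ 0 → count [] b ≡ 1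
count-empty b size-b = trans (cong (λ n → countWords n (Admissible? [] b)) size-b) only-empty-word
  where
  only-empty-word : countWords 0 (Admissible? [] b) ≡ 1
  only-empty-word with Admissible? [] b []
  ... | yes _    = refl
  ... | no  ¬adm = ⊥-elim (¬adm ((λ ()) , (λ ()) , (λ ())))

C : ∀ {k} → List ℕ → PowerSeries k
C js b = + count js b

act-1+x-C : ∀ {k} js (i : Fin k) → toℕ i ∉ js → ∀ b → act (1+x i) (C (toℕ i ∷ js)) b ≡ C js b
act-1+x-C js i i∉js b =
  begin
    act (1+x i) (C (toℕ i ∷ js)) b
  ≡⟨ act-1+x i (C (toℕ i ∷ js)) b ⟩
    C (toℕ i ∷ js) b ℤ.+ shift (basis i) (C (toℕ i ∷ js)) b
  ≡⟨ cong (λ y → C (toℕ i ∷ js) b ℤ.+ y) (trans (shift-basis i (C (toℕ i ∷ js)) b) (sym (+-if (1 ℕ.≤ᵇ lookup b i) _))) ⟩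
    + (count (toℕ i ∷ js) b ℕ.+ (if 1 ℕ.≤ᵇ lookup b i then count (toℕ i ∷ js) (b ∸ᵥ basis i) else 0))
  ≡⟨ cong +_ (sym (count-add-block js i i∉js b)) ⟩
    C js b
  ∎
  where open ≡-Reasoning

act-∏1+x-C : ∀ {k} (is : List (Fin k)) → Unique (map toℕ is) → ∀ b → act (∏1+x is) (C (map toℕ is)) b ≡ C [] b
act-∏1+x-C []       _                      b = trans (ZP.+-identityʳ _) (trans (ZP.*-identityˡ _) (shift-zero (C []) b))
act-∏1+x-C (i ∷ is) (i∉is ∷ distinct) b =
  begin
    act (1+x i ⊗ ∏1+x is) (C (toℕ i ∷ map toℕ is)) b
  ≡⟨ act-⊗ (1+x i) (∏1+x is) (C (toℕ i ∷ map toℕ is)) b ⟩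
    act (∏1+x is) (act (1+x i) (C (toℕ i ∷ map toℕ is))) b
  ≡⟨ act-cong (∏1+x is) (act-1+x-C (map toℕ is) i (All¬⇒¬Any i∉is)) b ⟩
    act (∏1+x is) (C (map toℕ is)) b
  ≡⟨ act-∏1+x-C is distinct b ⟩
    C [] b
  ∎
  where open ≡-Reasoning

act-1-Σx-C : ∀ k (b : Vec ℕ k) → act (1-Σx k) (C []) b ≡ one b
act-1-Σx-C k b with size b in size-b
... | zero =
  begin
    act (1-Σx k) (C []) b
  ≡⟨ act-1-Σx k (C []) b ⟩
    C [] b ℤ.- sumℤ (map (λ i → shift (basis i) (C []) b) (allFin k))
  ≡⟨ cong₂ ℤ._-_ (cong +_ (count-empty b size-b)) (trans (sumℤ-cong (allFin k) no-shift) (sumℤ-zero (allFin k))) ⟩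
    + 1
  ≡⟨ sym (proj₁ (mono-spec (zeroVec k) b) (size≡0⇒zeroVec b size-b)) ⟩
    one b
  ∎
  where
  open ≡-Reasoning
  no-shift : ∀ i → shift (basis i) (C []) b ≡ + 0
  no-shift i rewrite shift-basis i (C []) b
                   | ≤ᵇ-false {1} {lookup b i} (λ 1≤bᵢ → NP.<⇒≱ 1≤bᵢ
                       (subst (lookup b i ≤_) size-b (NP.m+n≤o⇒n≤o (blockStart b i) (blockEnd≤size b i)))) = refl
... | suc m =
  begin
    act (1-Σx k) (C []) b
  ≡⟨ act-1-Σx k (C []) b ⟩
    C [] b ℤ.- sumℤ (map (λ i → shift (basis i) (C []) b) (allFin k))
  ≡⟨ cong₂ ℤ._-_ (cong +_ (count-remove-max b size-b)) shifts ⟩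
    + S ℤ.- + S
  ≡⟨ ZP.+-inverseʳ (+ S) ⟩
    + 0
  ≡⟨ sym (proj₂ (mono-spec (zeroVec k) b) (λ b≡0 → NP.0≢1+n (trans (sym (trans (cong size b≡0) (size-zeroVec k))) size-b))) ⟩
    one b
  ∎
  where
  open ≡-Reasoning
  term : Fin k → ℕ
  term i = if 1 ℕ.≤ᵇ lookup b i then count [] (b ∸ᵥ basis i) else 0
  S : ℕ
  S = sum (map term (allFin k))
  shifts : sumℤ (map (λ i → shift (basis i) (C []) b) (allFin k)) ≡ + S
  shifts = trans (sumℤ-cong (allFin k) (λ i → trans (shift-basis i (C []) b) (sym (+-if (1 ℕ.≤ᵇ lookup b i) _))))
                 (sumℤ-ℕ term (allFin k))

theorem3 : (k j : ℕ) → j ≤ k → (b : Vec ℕ k) → (genD k j ⊛ denominator k j) b ≡ one b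
theorem3 k j j≤k b =
  begin
    (genD k j ⊛ denominator k j) b
  ≡⟨ ⊛-denominator k j (genD k j) b ⟩
    act (1-Σx k) (act (∏1+x is) (genD k j)) b
  ≡⟨ act-cong (1-Σx k) (act-cong (∏1+x is) (λ c → cong +_ (countD≡count j j≤k c))) b ⟩
    act (1-Σx k) (act (∏1+x is) (C (firstBlocks k j))) b
  ≡⟨ act-cong (1-Σx k) (act-∏1+x-C is (UP.map⁺ FP.toℕ-injective (UP.filter⁺ _ (UP.allFin⁺ k)))) b ⟩
    act (1-Σx k) (C []) b
  ≡⟨ act-1-Σx-C k b ⟩
    one b
  ∎
  where
  open ≡-Reasoning
  is : List (Fin k)
  is = firstIndices k j
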